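{- Let $N$ be a complete binary $\mathcal{L}$-network with leaf set $\mathcal{L}_0\subseteq\mathcal{L}$. For $a\in\mathcal{L}$, $a$ is a leaf of $N$ if and only if $\delta_a$ has multiplicity 1 in $\mu(N)$.
   Context: Networks. A semidirected graph $N=(V,E)$ has a finite node set and a finite multiset of edges $E=E_U\sqcup E_D$ (parallel edges allowed); edges in $E_U$ are undirected, each edge in $E_D$ is directed from parent to child, written $u\to v$. $v$ is a root if it has no incoming directed edge and no undirected edge, a leaf if it has no outgoing directed edge and no undirected edge, a tree node if it has at most one incoming directed edge, hybrid otherwise. Semidirected paths (cycles): their undirected edges can be oriented to make them directed; an SDAG has no semidirected cycle. $N$ is binary if roots have degree 0, 2 or 3, leaves degree 0 or 1, other nodes degree 3. For $\mathcal{L}=[n]$, an $\mathcal{L}$-network is an SDAG whose leaves are tree nodes, with an injective labelling of leaves by $\mathcal{L}$ (leaves identified with labels). $u\sim v$ if joined by a path of undirected edges; $N/{\sim}$ contracts all undirected edges. $N$ is complete if edges at leaves are directed towards leaves and no $\sim$-class with more than one node has an incoming directed edge in $N/{\sim}$. A root component is the subgraph induced by a $\sim$-class that is a root of $N/{\sim}$; resolved if it is a single node of degree 0 or 2, unresolved otherwise. $\mathrm{adm}(T)$: edges of $T$ plus all edges incident to nodes of $T$. $m(u,x;e)$ is the number of semidirected paths from $u$ to $x$ avoiding edge $e$. $\mu$-representation. Tags: $\mathsf{t},\mathsf{h},\mathsf{r},\mathsf{i}$. For an edge $e$ with endpoints $u,v$, $\mu(e,v)=(\mu_0,\dots,\mu_n)$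 with $\mu_i=m(v,i;e)$ for $i\in[n]$ (0 if $i$ not a leaf) and $\mu_0=\sum_{h\text{ hybrid}}m(v,h;e)$. $\delta_a$ is the $a$-th unit vector of $\mathbb{Z}^{n+1}$ (coordinates $0,\dots,n$). Root component $T$: $\mu(T)=\{(\delta_a,\mathsf{r})\}$ if $T$ is an isolated node labelled $a$, else $\{(\mu(e,u)+\mu(e,v),\mathsf{r})\}$ for any $e=uv\in\mathrm{adm}(T)$; $\mu(T)$ also denotes this vector. Edge $e$: if directed $u\to v$ and in $\mathrm{adm}(T)$ of no unresolved root component, $\mu(e)=\{(\mu(e,v),\tau)\}$ with $\tau=\mathsf{h}$ if $v$ hybrid else $\mathsf{t}$; if directed and in $\mathrm{adm}(T)$ of an unresolved $T$, $\mu(e)=\{(\mu(e,v),\tau),(\mu(T)-\mu(e,u),\mathsf{i})\}$; if undirected, $\{(\mu(e,v),\mathsf{t}),(\mu(e,u),\mathsf{t})\}$. $\mu(N)$ is the multiset of these $\mu$-entries over all edges and root components. A simple vector has multiplicity $k$ in $\mu(N)$ if exactly $k$ entries (counted with multiplicity) contain it. -}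

module Defs where

open import Data.Bool using (Bool; true; false; not; _∧_; _∨_; if_then_else_; T)
open import Data.Nat as ℕ using (ℕ; zero; suc; _≤_)
open import Data.Fin as Fin using (Fin; zero; suc)
open import Data.Integer as ℤ using (ℤ; +_)
open import Data.List as L using (List; []; _∷_; [_]; allFin; filter; concatMap; length; map; _++_)
open import Data.Bool.ListAction using (any; all)
open import Data.Nat.ListAction using (sum)
open import Data.Maybe using (Maybe; just; nothing)
open import Data.Vec as V using (Vec; tabulate)
open import Data.Vec.Properties using (≡-dec)
open import Data.Product using (_×_; _,_; proj₁; ∃; ∃-syntax)
open import Relation.Nullary.Decidable using (⌊_⌋)
open import Relation.Binary.PropositionalEquality using (_≡_)
open import Data.Empty using (⊥)
open import Data.Sum using (_⊎_)
import Data.Bool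

-- Finite semidirected multigraphs with leaf labels in 𝓛 = [n].
-- Label i : Fin n stands for the element (i+1) of [n] = {1,…,n};
-- it is coordinate (suc i) of ℤ^{n+1} (coordinates 0,…,n).
-- Nodes are Fin k; edges are Fin m (so parallel edges are allowed).
-- Edge e has endpoints src e, tgt e; if dir e ≡ true it is the
-- directed edge src e → tgt e, otherwise it is undirected.

record Graph (n : ℕ) : Set where
  field
    k   : ℕ
    m   : ℕ
    src : Fin m → Fin k
    tgt : Fin m → Fin k
    dir : Fin m → Bool
    lab : Fin k → Maybe (Fin n)

module _ {n : ℕ} (N : Graph n) where
  open Graph N

  infix 4 _==_
  _==_ : Fin k → Fin k → Bool
  x == y = ⌊ x Fin.≟ y ⌋

  _=ᵉ_ : Fin m → Fin m → Bool
  x =ᵉ y = ⌊ x Fin.≟ y ⌋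

  edges : List (Fin m)
  edges = allFin m

  nodes : List (Fin k)
  nodes = allFin k

  count : {A : Set} → (A → Bool) → List A → ℕ
  count p xs = length (filter (λ x → Data.Bool.T? (p x)) xs)

  dirIn dirOut undAt incident : Fin m → Fin k → Bool
  dirIn  e v = dir e ∧ (tgt e == v)
  dirOut e v = dir e ∧ (src e == v)
  undAt  e v = not (dir e) ∧ ((src e == v) ∨ (tgt e == v))
  incident e v = (src e == v) ∨ (tgt e == v)

  indeg : Fin k → ℕ
  indeg v = count (λ e → dirIn e v) edges

  -- degree (a loop would count twice)
  degree : Fin k → ℕ
  degree v = count (λ e → src e == v) edges ℕ.+ count (λ e → tgt e == v) edges

  isRoot isLeaf isTree isHybrid : Fin k → Bool
  isRoot v = (indeg v ℕ.≡ᵇ 0) ∧ not (any (λ e → undAt e v) edges)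
  isLeaf v = not (any (λ e → dirOut e v) edges) ∧ not (any (λ e → undAt e v) edges)
  isTree v = indeg v ℕ.≤ᵇ 1
  isHybrid v = not (isTree v)

  step : Fin m → Fin k → Fin k → Bool
  step e x y = (dir e ∧ (src e == x) ∧ (tgt e == y))
             ∨ (not (dir e) ∧ (((src e == x) ∧ (tgt e == y)) ∨ ((tgt e == x) ∧ (src e == y))))

  notIn : Fin k → List (Fin k) → Bool
  notIn y vis = all (λ z → not (y == z)) vis

  -- All semidirected paths (with pairwise distinct nodes) from u to x
  -- using only edges e with ok e ≡ true, listed as their edge sequences.
  -- 'vis' are the nodes already on the path; the fuel bounds the length.
  pathsFrom : ℕ → (Fin m → Bool) → List (Fin k) → Fin k → Fin k → List (List (Fin m))
  pathsFrom fuel ok vis u x with u == x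
  ... | true = [ [] ]
  pathsFrom zero ok vis u x | false = []
  pathsFrom (suc f) ok vis u x | false =
    concatMap (λ e → concatMap (λ y →
        if ok e ∧ step e u y ∧ notIn y vis
        then map (e ∷_) (pathsFrom f ok (y ∷ vis) y x)
        else []) nodes) edges

  paths : (Fin m → Bool) → Fin k → Fin k → List (List (Fin m))
  paths ok u x = pathsFrom k ok (u ∷ []) u x

  mcount : Fin k → Fin k → Fin m → ℕ
  mcount u x e = length (paths (λ j → not (j =ᵉ e)) u x)

  -- A semidirected cycle: a step x → y along e followed by a
  -- semidirected path from y back to x not using e (nodes distinct).
  HasSDCycle : Set
  HasSDCycle = ∃[ e ] ∃[ x ] ∃[ y ] (T (step e x y) × T (any (λ _ → true) (paths (λ j → not (j =ᵉ e)) y x)))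

  _∼_ : Fin k → Fin k → Bool
  u ∼ v = any (λ _ → true) (paths (λ j → not (dir j)) u v)

  nontrivialClass : Fin k → Bool
  nontrivialClass r = any (λ w → not (w == r) ∧ (w ∼ r)) nodes

  classHasIncoming : Fin k → Bool
  classHasIncoming r = any (λ e → dir e ∧ (tgt e ∼ r)) edges

  record IsLNetwork : Set where
    field
      sdag         : HasSDCycle → ⊥
      leavesTree   : ∀ v → T (isLeaf v) → T (isTree v)
      labelledLeaf : ∀ v → T (isLeaf v) → ∃[ a ] (lab v ≡ just a)
      onlyLeaves   : ∀ v a → lab v ≡ just a → T (isLeaf v)
      labInjective : ∀ v w a → lab v ≡ just a → lab w ≡ just a → v ≡ w

  record IsBinary : Set where
    field
      rootDeg  : ∀ v → T (isRoot v) → (degree v ≡ 0) ⊎ ((degree v ≡ 2) ⊎ (degree v ≡ 3))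
      leafDeg  : ∀ v → T (isLeaf v) → (degree v ≡ 0) ⊎ (degree v ≡ 1)
      otherDeg : ∀ v → T (not (isRoot v)) → T (not (isLeaf v)) → degree v ≡ 3

  record IsComplete : Set where
    field
      leafEdges : ∀ v e → T (isLeaf v) → T (incident e v) → T (dirIn e v)
      classes   : ∀ r → T (nontrivialClass r) → T (not (classHasIncoming r))

  ℤⁿ⁺¹ : Set
  ℤⁿ⁺¹ = Vec ℤ (suc n)

  data Tag : Set where
    tt hh rr ii : Tag

  Entry : Set
  Entry = List (ℤⁿ⁺¹ × Tag)

  δ : Fin n → ℤⁿ⁺¹
  δ a = tabulate (λ i → if ⌊ i Fin.≟ suc a ⌋ then + 1 else + 0)

  labelledBy : Fin k → Fin n → Bool
  labelledBy w a with lab w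
  ... | just b  = ⌊ b Fin.≟ a ⌋
  ... | nothing = false

  μev : Fin m → Fin k → ℤⁿ⁺¹
  μev e v = tabulate coord
    where
    coord : Fin (suc n) → ℤ
    coord zero    = + sum (map (λ h → if isHybrid h then mcount v h e else 0) nodes)
    coord (suc a) = + sum (map (λ w → if labelledBy w a then mcount v w e else 0) nodes)

  -- Root components are represented by the least node of their ∼-class.
  isRep : Fin k → Bool
  isRep r = all (λ w → not (w ∼ r) ∨ ⌊ r Fin.≤? w ⌋) nodes

  isRootComp : Fin k → Bool
  isRootComp r = isRep r ∧ not (classHasIncoming r)

  rootComps : List (Fin k)
  rootComps = filter (λ r → Data.Bool.T? (isRootComp r)) nodes

  resolved : Fin k → Bool
  resolved r = not (nontrivialClass r) ∧ ((degree r ℕ.≡ᵇ 0) ∨ (degree r ℕ.≡ᵇ 2))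

  -- e ∈ adm(T) for the ∼-class T of r
  inAdm : Fin m → Fin k → Bool
  inAdm e r = (src e ∼ r) ∨ (tgt e ∼ r)

  zeroV : ℤⁿ⁺¹
  zeroV = V.replicate (suc n) (+ 0)

  firstEdge : (Fin m → Bool) → List (Fin m) → Maybe (Fin m)
  firstEdge p [] = nothing
  firstEdge p (e ∷ es) = if p e then just e else firstEdge p es

  -- μ(T): δ_a for an isolated node labelled a; otherwise
  -- μ(e,u)+μ(e,v) for an edge e = uv ∈ adm(T) (the first one; the
  -- paper states this does not depend on the choice).
  μT : Fin k → ℤⁿ⁺¹
  μT r with lab r | degree r | firstEdge (λ e → inAdm e r) edges
  ... | just a | zero | _ = δ a
  ... | _ | _ | just e = V.zipWith ℤ._+_ (μev e (src e)) (μev e (tgt e))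
  ... | _ | _ | nothing = zeroV

  unresolvedAt : Fin m → Maybe (Fin k)
  unresolvedAt e = firstRC rootComps
    where
    firstRC : List (Fin k) → Maybe (Fin k)
    firstRC [] = nothing
    firstRC (r ∷ rs) = if not (resolved r) ∧ inAdm e r then just r else firstRC rs

  μedge : Fin m → Entry
  μedge e with dir e | unresolvedAt e
  ... | false | _ = (μev e (tgt e) , tt) ∷ (μev e (src e) , tt) ∷ []
  ... | true | nothing = (μev e (tgt e) , τ) ∷ []
    where τ = if isHybrid (tgt e) then hh else tt
  ... | true | just r =
        (μev e (tgt e) , τ) ∷ (V.zipWith ℤ._-_ (μT r) (μev e (src e)) , ii) ∷ []
    where τ = if isHybrid (tgt e) then hh else tt

  -- μ(N) as a list (multiset) of entries
  μN : List Entry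
  μN = map μedge edges ++ map (λ r → (μT r , rr) ∷ []) rootComps

  contains : ℤⁿ⁺¹ → Entry → Bool
  contains w en = any (λ p → ⌊ ≡-dec ℤ._≟_ (proj₁ p) w ⌋) en

  multiplicity : ℤⁿ⁺¹ → ℕ
  multiplicity w = count (contains w) μN

  IsLeafLabel : Fin n → Set
  IsLeafLabel a = ∃[ v ] (T (isLeaf v) × lab v ≡ just a)

{-# OPTIONS --safe #-}

-- If no node carries the label a, coordinate a vanishes in every vector of μ(N), so δ_a does
-- not occur at all. Otherwise let v be the leaf labelled a. Nothing leaves v, so μ(e,v) = δ_a
-- for an edge e into v, and μ(T) = δ_a for the root component T = {v} when v is isolated; as v
-- has degree 0 or 1, exactly one of these entries occurs. No other vector equals δ_a. If w ≠ v
-- is a head of e, then either w is itself a hybrid or a leaf, or w is a tree node with two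
-- further ways out; in an acyclic binary network, walking on along each of them while avoiding
-- e ends at a hybrid or a leaf, so μ(e,w) has a positive coordinate other than a, or coordinate
-- a at least 2. For the same reason both summands of μ(T) = μ(e,u) + μ(e,w) are nonzero.
-- Finally the i-entry μ(T) − μ(e,u) of an edge e = uw equals μ(e,w): for a hybrid or leaf x,
-- m(u,x;e) + m(w,x;e) counts all paths from u to x, and this count does not change along the
-- undirected edges of T, so it is the same for every edge of adm(T).

module Submission where

open import Defs
open import Data.Bool using (Bool; true; false; not; _∧_; _∨_; if_then_else_; T; T?)
open import Data.Bool.Properties using (∧-zeroʳ; ∧-identityʳ; ∨-zeroʳ; ∨-identityʳ; ∨-idem; T-≡)
open import Data.Bool.ListAction using (any; all)
open import Data.Empty using (⊥; ⊥-elim)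
open import Data.Fin as Fin using (Fin; zero; suc)
open import Data.Fin.Properties using (injective⇒≤; suc-injective)
open import Data.Integer as ℤ using (ℤ)
import Data.Integer.Properties as ℤ
open import Data.List as List using (List; []; _∷_; filter; concatMap; length; map; _++_)
open import Data.List.Properties using (length-++; length-map; ++-assoc; ++-identityʳ; concatMap-cong; ∷-injectiveˡ)
open import Data.List.Membership.Propositional using (_∈_; _∉_; find; lose)
open import Data.List.Membership.Propositional.Properties
  using (∈-++⁺ˡ; ∈-++⁺ʳ; ∈-map⁺; ∈-map⁻; ∈-allFin; ∈-lookup; ∈-length; ∈-concatMap⁺; ∈-concatMap⁻; ∈-filter⁺; ∈-filter⁻)
open import Data.List.Relation.Unary.Any using (here; there)
open import Data.List.Relation.Unary.All using ([]; _∷_)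
open import Data.List.Relation.Unary.All.Properties using (¬Any⇒All¬; All¬⇒¬Any)
open import Data.List.Relation.Unary.AllPairs using ([]; _∷_)
open import Data.List.Relation.Binary.Subset.Propositional using (_⊆_)
open import Data.List.Relation.Unary.Unique.Propositional using (Unique)
open import Data.List.Relation.Unary.Unique.Propositional.Properties using (allFin⁺; filter⁺; Unique[x∷xs]⇒x∉xs)
open import Data.Maybe using (Maybe; just; nothing)
open import Data.Nat as ℕ using (ℕ; zero; suc; _+_; _≤_; _<_; z≤n; s≤s)
import Data.Nat.Properties as ℕ
open import Data.Nat.ListAction using (sum)
open import Data.Product using (_×_; _,_; proj₁; proj₂; ∃-syntax; Σ)
open import Data.Sum using (_⊎_; inj₁; inj₂)
open import Data.Unit using (⊤; tt)
open import Data.Vec as Vec using (Vec; lookup)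
open import Data.Vec.Properties using (lookup∘tabulate; tabulate∘lookup; tabulate-cong; lookup-zipWith; lookup-replicate; ≡-dec)
open import Function.Bundles using (_⇔_; mk⇔; Equivalence)
open import Relation.Nullary using (¬_; Dec; yes; no)
open import Relation.Nullary.Decidable using (⌊_⌋)
open import Relation.Binary.PropositionalEquality
  using (_≡_; _≢_; refl; sym; trans; cong; cong₂; subst; subst₂; module ≡-Reasoning)

∧-true⁻ : ∀ {a b} → a ∧ b ≡ true → a ≡ true × b ≡ true
∧-true⁻ {true} {true} _ = refl , refl

∨-true⁻ : ∀ {a b} → a ∨ b ≡ true → a ≡ true ⊎ b ≡ true
∨-true⁻ {true} _ = inj₁ refl
∨-true⁻ {false} b≡true = inj₂ b≡true

∨-false⁻ : ∀ {a b} → a ∨ b ≡ false → a ≡ false × b ≡ false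
∨-false⁻ {false} {false} _ = refl , refl

not-true⁻ : ∀ {a} → not a ≡ true → a ≡ false
not-true⁻ {false} _ = refl

not-false⁻ : ∀ {a} → not a ≡ false → a ≡ true
not-false⁻ {true} _ = refl

true≢false : true ≢ false
true≢false ()

T⇒≡true : ∀ {a} → T a → a ≡ true
T⇒≡true = Equivalence.to T-≡

≡true⇒T : ∀ {a} → a ≡ true → T a
≡true⇒T = Equivalence.from T-≡

Fin⇒suc : ∀ {p} → Fin p → ∃[ p′ ] (p ≡ suc p′)
Fin⇒suc {suc p} _ = p , refl

⌊⌋-yes : ∀ {P : Set} (P? : Dec P) → P → ⌊ P? ⌋ ≡ true
⌊⌋-yes (yes _) _ = refl
⌊⌋-yes (no ¬p) p = ⊥-elim (¬p p)

⌊⌋-no : ∀ {P : Set} (P? : Dec P) → ¬ P → ⌊ P? ⌋ ≡ false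
⌊⌋-no (yes p) ¬p = ⊥-elim (¬p p)
⌊⌋-no (no _) _ = refl

⌊⌋-true⁻ : ∀ {P : Set} (P? : Dec P) → ⌊ P? ⌋ ≡ true → P
⌊⌋-true⁻ (yes p) _ = p

module _ {p : ℕ} where

  ⌊≟⌋-refl : (x : Fin p) → ⌊ x Fin.≟ x ⌋ ≡ true
  ⌊≟⌋-refl x = ⌊⌋-yes (x Fin.≟ x) refl

  ⌊≟⌋⇒≡ : {x y : Fin p} → ⌊ x Fin.≟ y ⌋ ≡ true → x ≡ y
  ⌊≟⌋⇒≡ {x} {y} = ⌊⌋-true⁻ (x Fin.≟ y)

  ≢⇒⌊≟⌋≡false : {x y : Fin p} → x ≢ y → ⌊ x Fin.≟ y ⌋ ≡ false
  ≢⇒⌊≟⌋≡false {x} {y} = ⌊⌋-no (x Fin.≟ y)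

  ⌊≟⌋-cases : (x y : Fin p) → (x ≡ y × ⌊ x Fin.≟ y ⌋ ≡ true) ⊎ (x ≢ y × ⌊ x Fin.≟ y ⌋ ≡ false)
  ⌊≟⌋-cases x y with x Fin.≟ y
  ... | yes x≡y = inj₁ (x≡y , refl)
  ... | no x≢y = inj₂ (x≢y , refl)

  Unique⇒length≤ : (xs : List (Fin p)) → Unique xs → length xs ≤ p
  Unique⇒length≤ xs u = injective⇒≤ (lookup-injective xs u)
    where
    lookup-injective : (xs : List (Fin p)) → Unique xs → ∀ {i j} → List.lookup xs i ≡ List.lookup xs j → i ≡ j
    lookup-injective (x ∷ xs) (_ ∷ u) {zero}  {zero}  _ = refl
    lookup-injective (x ∷ xs) (x∉ ∷ _) {zero}  {suc j} x≡ = ⊥-elim (All¬⇒¬Any x∉ (subst (_∈ xs) (sym x≡) (∈-lookup j)))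
    lookup-injective (x ∷ xs) (x∉ ∷ _) {suc i} {zero}  ≡x = ⊥-elim (All¬⇒¬Any x∉ (subst (_∈ xs) ≡x (∈-lookup i)))
    lookup-injective (x ∷ xs) (_ ∷ u) {suc i} {suc j} eq = cong suc (lookup-injective xs u eq)

Unique-∷ : ∀ {A : Set} {x : A} {xs} → x ∉ xs → Unique xs → Unique (x ∷ xs)
Unique-∷ {xs = xs} x∉xs u = ¬Any⇒All¬ xs x∉xs ∷ u

Unique-pair : ∀ {A : Set} {x y : A} → x ≢ y → Unique (x ∷ y ∷ [])
Unique-pair x≢y = (x≢y ∷ []) ∷ [] ∷ []

Unique-++⁻ˡ : ∀ {A : Set} (xs : List A) {ys} → Unique (xs ++ ys) → Unique xs
Unique-++⁻ˡ [] _ = []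
Unique-++⁻ˡ (x ∷ xs) (x∉ ∷ u) = ¬Any⇒All¬ xs (λ x∈ → All¬⇒¬Any x∉ (∈-++⁺ˡ x∈)) ∷ Unique-++⁻ˡ xs u

distinct∈⇒2≤length : ∀ {A : Set} {x y : A} {xs} → x ∈ xs → y ∈ xs → x ≢ y → 2 ≤ length xs
distinct∈⇒2≤length (here refl) (here refl) x≢y = ⊥-elim (x≢y refl)
distinct∈⇒2≤length (here _)    (there y∈)  _   = s≤s (∈-length y∈)
distinct∈⇒2≤length (there x∈)  (here _)    _   = s≤s (∈-length x∈)
distinct∈⇒2≤length (there x∈)  (there y∈)  x≢y = ℕ.m≤n⇒m≤1+n (distinct∈⇒2≤length x∈ y∈ x≢y)

module _ {A : Set} where

  sum-map-cong : ∀ {f g : A → ℕ} xs → (∀ x → x ∈ xs → f x ≡ g x) → sum (map f xs) ≡ sum (map g xs)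
  sum-map-cong [] _ = refl
  sum-map-cong (x ∷ xs) f≗g = cong₂ _+_ (f≗g x (here refl)) (sum-map-cong xs (λ y y∈ → f≗g y (there y∈)))

  sum-map-≡0 : ∀ {f : A → ℕ} xs → (∀ x → x ∈ xs → f x ≡ 0) → sum (map f xs) ≡ 0
  sum-map-≡0 [] _ = refl
  sum-map-≡0 (x ∷ xs) f≗0 = cong₂ _+_ (f≗0 x (here refl)) (sum-map-≡0 xs (λ y y∈ → f≗0 y (there y∈)))

  sum-map-mono : ∀ {f g : A → ℕ} xs → (∀ x → x ∈ xs → f x ≤ g x) → sum (map f xs) ≤ sum (map g xs)
  sum-map-mono [] _ = z≤n
  sum-map-mono (x ∷ xs) f≤g = ℕ.+-mono-≤ (f≤g x (here refl)) (sum-map-mono xs (λ y y∈ → f≤g y (there y∈)))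

  sum-map-+ : ∀ (f g : A → ℕ) xs → sum (map f xs) + sum (map g xs) ≡ sum (map (λ x → f x + g x) xs)
  sum-map-+ f g [] = refl
  sum-map-+ f g (x ∷ xs) = begin
    (f x + F) + (g x + G)  ≡⟨ ℕ.+-assoc (f x) F (g x + G) ⟩
    f x + (F + (g x + G))  ≡⟨ cong (f x +_) (ℕ.+-comm F (g x + G)) ⟩
    f x + ((g x + G) + F)  ≡⟨ cong (f x +_) (ℕ.+-assoc (g x) G F) ⟩
    f x + (g x + (G + F))  ≡⟨ sym (ℕ.+-assoc (f x) (g x) (G + F)) ⟩
    (f x + g x) + (G + F)  ≡⟨ cong (_+_ (f x + g x)) (trans (ℕ.+-comm G F) (sum-map-+ f g xs)) ⟩
    (f x + g x) + sum (map (λ y → f y + g y) xs) ∎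
    where
    open ≡-Reasoning
    F = sum (map f xs)
    G = sum (map g xs)

  sum-map-if : ∀ b (f : A → ℕ) xs → sum (map (λ y → if b then f y else 0) xs) ≡ (if b then sum (map f xs) else 0)
  sum-map-if true f xs = refl
  sum-map-if false f xs = sum-map-≡0 xs (λ _ _ → refl)

  ∈⇒≤sum-map : ∀ (f : A → ℕ) {x} xs → x ∈ xs → f x ≤ sum (map f xs)
  ∈⇒≤sum-map f (y ∷ xs) (here refl) = ℕ.m≤m+n (f y) _
  ∈⇒≤sum-map f (y ∷ xs) (there x∈) = ℕ.≤-trans (∈⇒≤sum-map f xs x∈) (ℕ.m≤n+m _ (f y))

  sum-map-if-single : ∀ (sel : A → Bool) (f : A → ℕ) {x} xs → Unique xs → x ∈ xs →
                      (∀ y → sel y ≡ true → y ≡ x) → sel x ≡ true →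
                      sum (map (λ y → if sel y then f y else 0) xs) ≡ f x
  sum-map-if-single sel f (x ∷ xs) (x∉ ∷ _) (here refl) only-x sel-x
    rewrite sel-x = trans (cong (f x +_) (sum-map-≡0 xs vanish)) (ℕ.+-identityʳ (f x))
    where
    vanish : ∀ y → y ∈ xs → (if sel y then f y else 0) ≡ 0
    vanish y y∈ with sel y in sel-y
    ... | true = ⊥-elim (All¬⇒¬Any x∉ (subst (_∈ xs) (only-x y sel-y) y∈))
    ... | false = refl
  sum-map-if-single sel f (y ∷ xs) (y∉ ∷ u) (there x∈) only-x sel-x with sel y in sel-y
  ... | true = ⊥-elim (All¬⇒¬Any y∉ (subst (_∈ xs) (sym (only-x y sel-y)) x∈))
  ... | false = sum-map-if-single sel f xs u x∈ only-x sel-x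

length-concatMap : ∀ {A B : Set} (f : A → List B) xs → length (concatMap f xs) ≡ sum (map (λ x → length (f x)) xs)
length-concatMap f [] = refl
length-concatMap f (x ∷ xs) = trans (length-++ (f x)) (cong (length (f x) +_) (length-concatMap f xs))

𝟙 : Bool → ℕ
𝟙 b = if b then 1 else 0

𝟙≤1 : ∀ b → 𝟙 b ≤ 1
𝟙≤1 true = s≤s z≤n
𝟙≤1 false = z≤n

tally : ∀ {A : Set} → (A → Bool) → List A → ℕ
tally p xs = sum (map (λ x → 𝟙 (p x)) xs)

module _ {A : Set} where

  count≡tally : ∀ {n} (N : Graph n) (p : A → Bool) xs → count N p xs ≡ tally p xs
  count≡tally N p [] = refl
  count≡tally N p (x ∷ xs) with p x
  ... | true = cong suc (count≡tally N p xs)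
  ... | false = count≡tally N p xs

  tally-cong : ∀ {p q : A → Bool} xs → (∀ x → x ∈ xs → p x ≡ q x) → tally p xs ≡ tally q xs
  tally-cong xs p≗q = sum-map-cong xs (λ x x∈ → cong 𝟙 (p≗q x x∈))

  tally-≡0 : ∀ (p : A → Bool) xs → (∀ x → x ∈ xs → p x ≡ false) → tally p xs ≡ 0
  tally-≡0 p xs none = sum-map-≡0 xs (λ x x∈ → cong 𝟙 (none x x∈))

  tally-++ : ∀ (p : A → Bool) xs ys → tally p (xs ++ ys) ≡ tally p xs + tally p ys
  tally-++ p [] ys = refl
  tally-++ p (x ∷ xs) ys = trans (cong (𝟙 (p x) +_) (tally-++ p xs ys)) (sym (ℕ.+-assoc (𝟙 (p x)) _ _))

  tally-map : ∀ {B : Set} (p : B → Bool) (f : A → B) xs → tally p (map f xs) ≡ tally (λ x → p (f x)) xs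
  tally-map p f [] = refl
  tally-map p f (x ∷ xs) = cong (𝟙 (p (f x)) +_) (tally-map p f xs)

  tally-+-mono : ∀ (p q r s : A → Bool) xs →
                 (∀ x → x ∈ xs → 𝟙 (p x) + 𝟙 (q x) ≤ 𝟙 (r x) + 𝟙 (s x)) →
                 tally p xs + tally q xs ≤ tally r xs + tally s xs
  tally-+-mono p q r s xs pointwise =
    subst₂ _≤_ (sym (sum-map-+ (λ x → 𝟙 (p x)) (λ x → 𝟙 (q x)) xs)) (sym (sum-map-+ (λ x → 𝟙 (r x)) (λ x → 𝟙 (s x)) xs))
      (sum-map-mono xs pointwise)

  tally≥1⇒∃ : ∀ (p : A → Bool) xs → 1 ≤ tally p xs → ∃[ x ] (x ∈ xs × p x ≡ true)
  tally≥1⇒∃ p (y ∷ xs) pos with p y in p-y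
  ... | true = y , here refl , p-y
  ... | false with tally≥1⇒∃ p xs pos
  ... | x , x∈ , p-x = x , there x∈ , p-x

  tally≥2⇒∃₂ : ∀ (p : A → Bool) xs → Unique xs → 2 ≤ tally p xs →
               ∃[ x ] ∃[ z ] (p x ≡ true × p z ≡ true × x ≢ z)
  tally≥2⇒∃₂ p (y ∷ xs) (y∉ ∷ u) two with p y in p-y
  ... | false = tally≥2⇒∃₂ p xs u two
  ... | true with tally≥1⇒∃ p xs (ℕ.≤-pred two)
  ... | x , x∈ , p-x = y , x , p-y , p-x , λ y≡x → All¬⇒¬Any y∉ (subst (_∈ xs) (sym y≡x) x∈)

module _ {p : ℕ} where

  tally-≤-drop : ∀ (q : Fin p → Bool) (h : Fin p) xs → Unique xs →
                 tally q xs ≤ 𝟙 (q h) + tally (λ x → q x ∧ not ⌊ x Fin.≟ h ⌋) xs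
  tally-≤-drop q h [] _ = z≤n
  tally-≤-drop q h (y ∷ xs) (y∉ ∷ u) with ⌊≟⌋-cases y h
  ... | inj₁ (refl , y≐h) rewrite y≐h | ∧-zeroʳ (q y) =
    ℕ.+-monoʳ-≤ (𝟙 (q y)) (ℕ.≤-reflexive (tally-cong xs (λ x x∈ → sym (keep x x∈))))
    where
    keep : ∀ x → x ∈ xs → q x ∧ not ⌊ x Fin.≟ y ⌋ ≡ q x
    keep x x∈ rewrite ≢⇒⌊≟⌋≡false (λ x≡y → All¬⇒¬Any y∉ (subst (_∈ xs) x≡y x∈)) = ∧-identityʳ (q x)
  ... | inj₂ (_ , y≐h) rewrite y≐h | ∧-identityʳ (q y) = begin
    𝟙 (q y) + tally q xs          ≤⟨ ℕ.+-monoʳ-≤ (𝟙 (q y)) (tally-≤-drop q h xs u) ⟩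
    𝟙 (q y) + (𝟙 (q h) + rest)    ≡⟨ sym (ℕ.+-assoc (𝟙 (q y)) _ rest) ⟩
    𝟙 (q y) + 𝟙 (q h) + rest      ≡⟨ cong (_+ rest) (ℕ.+-comm (𝟙 (q y)) _) ⟩
    𝟙 (q h) + 𝟙 (q y) + rest      ≡⟨ ℕ.+-assoc (𝟙 (q h)) _ rest ⟩
    𝟙 (q h) + (𝟙 (q y) + rest)    ∎
    where
    open ℕ.≤-Reasoning
    rest = tally (λ x → q x ∧ not ⌊ x Fin.≟ h ⌋) xs

any-const-true⁺ : ∀ {A : Set} {x : A} {xs} → x ∈ xs → any (λ _ → true) xs ≡ true
any-const-true⁺ (here _) = refl
any-const-true⁺ (there _) = refl

any-const-true⁻ : ∀ {A : Set} (xs : List A) → any (λ _ → true) xs ≡ true → ∃[ x ] (x ∈ xs)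
any-const-true⁻ (x ∷ _) _ = x , here refl

any⁺ : ∀ {A : Set} (p : A → Bool) {x} xs → x ∈ xs → p x ≡ true → any p xs ≡ true
any⁺ p (y ∷ xs) (here refl) p-y rewrite p-y = refl
any⁺ p (y ∷ xs) (there x∈) p-x with p y
... | true = refl
... | false = any⁺ p xs x∈ p-x

any⁻ : ∀ {A : Set} (p : A → Bool) xs → any p xs ≡ true → ∃[ x ] (x ∈ xs × p x ≡ true)
any⁻ p (y ∷ xs) some with p y in p-y
... | true = y , here refl , p-y
... | false with any⁻ p xs some
... | x , x∈ , p-x = x , there x∈ , p-x

any-false : ∀ {A : Set} (p : A → Bool) xs → (∀ x → x ∈ xs → p x ≡ false) → any p xs ≡ false
any-false p [] _ = refl
any-false p (y ∷ xs) none rewrite none y (here refl) = any-false p xs (λ x x∈ → none x (there x∈))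

all⁺ : ∀ {A : Set} (p : A → Bool) xs → (∀ x → x ∈ xs → p x ≡ true) → all p xs ≡ true
all⁺ p [] _ = refl
all⁺ p (y ∷ xs) every rewrite every y (here refl) = all⁺ p xs (λ x x∈ → every x (there x∈))

first-match-just : ∀ {A : Set} (p : A → Bool) (F : List A → Maybe A) → F [] ≡ nothing →
                   (∀ r rs → F (r ∷ rs) ≡ (if p r then just r else F rs)) →
                   ∀ rs r → F rs ≡ just r → r ∈ rs × p r ≡ true
first-match-just p F F[] F∷ [] r found with trans (sym F[]) found
... | ()
first-match-just p F F[] F∷ (r′ ∷ rs) r found with p r′ in p-r′ | F∷ r′ rs
... | true | F≡ with trans (sym F≡) found
... | refl = here refl , p-r′
first-match-just p F F[] F∷ (r′ ∷ rs) r found | false | F≡ with first-match-just p F F[] F∷ rs r (trans (sym F≡) found)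
... | r∈ , p-r = there r∈ , p-r

firstEdge-just : ∀ {n} (N : Graph n) p es e → firstEdge N p es ≡ just e → p e ≡ true
firstEdge-just N p (e′ ∷ es) e found with p e′ in p-e′
firstEdge-just N p (e′ ∷ es) e refl | true = p-e′
firstEdge-just N p (e′ ∷ es) e found | false = firstEdge-just N p es e found

firstEdge-nothing : ∀ {n} (N : Graph n) p es e → firstEdge N p es ≡ nothing → e ∈ es → p e ≡ false
firstEdge-nothing N p (e′ ∷ es) e none e∈ with p e′ in p-e′
firstEdge-nothing N p (e′ ∷ es) e () e∈ | true
firstEdge-nothing N p (e′ ∷ es) e none (here refl) | false = p-e′
firstEdge-nothing N p (e′ ∷ es) e none (there e∈) | false = firstEdge-nothing N p es e none e∈

pos-sum-minus : ∀ a b c d → a + b ≡ c + d → (ℤ.+ a ℤ.+ ℤ.+ b) ℤ.- ℤ.+ c ≡ ℤ.+ d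
pos-sum-minus a b c d a+b≡c+d = begin
  (ℤ.+ a ℤ.+ ℤ.+ b) ℤ.- ℤ.+ c  ≡⟨ cong (ℤ._- ℤ.+ c) (sym (ℤ.pos-+ a b)) ⟩
  ℤ.+ (a + b) ℤ.- ℤ.+ c        ≡⟨ ℤ.[+m]-[+n]≡m⊖n (a + b) c ⟩
  (a + b) ℤ.⊖ c                ≡⟨ cong (ℤ._⊖ c) a+b≡c+d ⟩
  (c + d) ℤ.⊖ c                ≡⟨ ℤ.≤-⊖ (ℕ.m≤m+n c d) ⟩
  ℤ.+ (c + d ℕ.∸ c)            ≡⟨ cong ℤ.+_ (ℕ.m+n∸m≡n c d) ⟩
  ℤ.+ d                        ∎
  where open ≡-Reasoning

lookup-ext : ∀ {A : Set} {p} (X Y : Vec A p) → (∀ i → lookup X i ≡ lookup Y i) → X ≡ Y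
lookup-ext X Y X≗Y = trans (sym (tabulate∘lookup X)) (trans (tabulate-cong X≗Y) (tabulate∘lookup Y))

module Semidirected {n : ℕ} (N : Graph n) where

  open Graph N

  infix 4 _≐_ _≐ᵉ_
  _≐_ : Fin k → Fin k → Bool
  _≐_ = _==_ N

  _≐ᵉ_ : Fin m → Fin m → Bool
  _≐ᵉ_ = _=ᵉ_ N

  Incident : Fin m → Fin k → Set
  Incident g z = src g ≡ z ⊎ tgt g ≡ z

  step-ends : ∀ g u y → step N g u y ≡ true → (src g ≡ u × tgt g ≡ y) ⊎ (tgt g ≡ u × src g ≡ y)
  step-ends g u y s with dir g | src g Fin.≟ u | tgt g Fin.≟ y | tgt g Fin.≟ u | src g Fin.≟ y
  ... | _     | yes su | yes ty | _      | _      = inj₁ (su , ty)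
  ... | false | _      | _      | yes tu | yes sy = inj₂ (tu , sy)
  step-ends g u y () | true  | no _  | _     | _     | _
  step-ends g u y () | true  | yes _ | no _  | _     | _
  step-ends g u y () | false | no _  | _     | no _  | _
  step-ends g u y () | false | no _  | _     | yes _ | no _
  step-ends g u y () | false | yes _ | no _  | no _  | _
  step-ends g u y () | false | yes _ | no _  | yes _ | no _

  step-directed : ∀ g u y → dir g ≡ true → step N g u y ≡ true → src g ≡ u × tgt g ≡ y
  step-directed g u y d s with step-ends g u y s
  ... | inj₁ ends = ends
  ... | inj₂ _ with dir g | src g Fin.≟ u | tgt g Fin.≟ y
  step-directed g u y refl _  | inj₂ _ | true | yes su | yes ty = su , ty
  step-directed g u y refl () | inj₂ _ | true | no _   | _
  step-directed g u y refl () | inj₂ _ | true | yes _  | no _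

  step-forward : ∀ g → step N g (src g) (tgt g) ≡ true
  step-forward g rewrite ⌊≟⌋-refl (src g) | ⌊≟⌋-refl (tgt g) with dir g
  ... | true = refl
  ... | false = refl

  step-backward : ∀ g → dir g ≡ false → step N g (tgt g) (src g) ≡ true
  step-backward g d rewrite d | ⌊≟⌋-refl (src g) | ⌊≟⌋-refl (tgt g) = ∨-zeroʳ _

  step-reverse : ∀ e u y → dir e ≡ false → step N e u y ≡ true → step N e y u ≡ true
  step-reverse e u y d s with step-ends e u y s
  ... | inj₁ (refl , refl) = step-backward e d
  ... | inj₂ (refl , refl) = step-forward e

  step-incidentˢ : ∀ g u y → step N g u y ≡ true → Incident g u
  step-incidentˢ g u y s with step-ends g u y s
  ... | inj₁ (su , _) = inj₁ su
  ... | inj₂ (tu , _) = inj₂ tu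

  step-incidentᵗ : ∀ g u y → step N g u y ≡ true → Incident g y
  step-incidentᵗ g u y s with step-ends g u y s
  ... | inj₁ (_ , ty) = inj₂ ty
  ... | inj₂ (_ , sy) = inj₁ sy

  step-incident : ∀ g u y z → step N g u y ≡ true → Incident g z → z ≡ u ⊎ z ≡ y
  step-incident g u y z s inc with step-ends g u y s | inc
  ... | inj₁ (su , _)  | inj₁ sz = inj₁ (trans (sym sz) su)
  ... | inj₁ (_ , ty)  | inj₂ tz = inj₂ (trans (sym tz) ty)
  ... | inj₂ (_ , sy)  | inj₁ sz = inj₂ (trans (sym sz) sy)
  ... | inj₂ (tu , _)  | inj₂ tz = inj₁ (trans (sym tz) tu)

  notIn⇒∉ : ∀ y vis → notIn N y vis ≡ true → y ∉ vis
  notIn⇒∉ y (z ∷ vis) fresh (here refl) with ∧-true⁻ {a = not (y ≐ y)} fresh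
  ... | y≢y , _ with trans (sym (not-true⁻ y≢y)) (⌊≟⌋-refl y)
  ... | ()
  notIn⇒∉ y (z ∷ vis) fresh (there y∈) = notIn⇒∉ y vis (proj₂ (∧-true⁻ fresh)) y∈

  ∉⇒notIn : ∀ y vis → y ∉ vis → notIn N y vis ≡ true
  ∉⇒notIn y [] _ = refl
  ∉⇒notIn y (z ∷ vis) y∉ rewrite ≢⇒⌊≟⌋≡false {x = y} {y = z} (λ y≡z → y∉ (here y≡z)) =
    ∉⇒notIn y vis (λ y∈ → y∉ (there y∈))

  ∈⇒notIn≡false : ∀ y vis → y ∈ vis → notIn N y vis ≡ false
  ∈⇒notIn≡false y vis y∈ with notIn N y vis in fresh
  ... | false = refl
  ... | true = ⊥-elim (notIn⇒∉ y vis fresh y∈)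

  notIn-∷ʳ : ∀ y vis s → y ≢ s → notIn N y (vis ++ (s ∷ [])) ≡ notIn N y vis
  notIn-∷ʳ y [] s y≢s rewrite ≢⇒⌊≟⌋≡false y≢s = refl
  notIn-∷ʳ y (z ∷ vis) s y≢s rewrite notIn-∷ʳ y vis s y≢s = refl

  CanStep : (Fin m → Bool) → List (Fin k) → Fin k → Fin m → Fin k → Bool
  CanStep ok vis u e y = ok e ∧ step N e u y ∧ notIn N y vis

  canStep⁻ : ∀ {ok vis u e y} → CanStep ok vis u e y ≡ true → ok e ≡ true × step N e u y ≡ true × y ∉ vis
  canStep⁻ {ok} {vis} {u} {e} {y} can with ∧-true⁻ {a = ok e} can
  ... | ok-e , rest with ∧-true⁻ {a = step N e u y} rest
  ... | s , fresh = ok-e , s , notIn⇒∉ y vis fresh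

  canStep⁺ : ∀ {ok vis u e y} → ok e ≡ true → step N e u y ≡ true → y ∉ vis → CanStep ok vis u e y ≡ true
  canStep⁺ {ok} {vis} {u} {e} {y} ok-e s y∉ rewrite ok-e | s | ∉⇒notIn y vis y∉ = refl

  canStep-¬step : ∀ ok vis u e y → step N e u y ≡ false → CanStep ok vis u e y ≡ false
  canStep-¬step ok vis u e y ¬s rewrite ¬s = ∧-zeroʳ (ok e)

  Extensions : (Fin m → Bool) → List (Fin k) → Fin k → Fin k → ℕ → Fin m → Fin k → List (List (Fin m))
  Extensions ok vis u x f e y =
    if CanStep ok vis u e y then map (e ∷_) (pathsFrom N f ok (y ∷ vis) y x) else []

  pathsFrom-arrived : ∀ f ok vis u x → (u ≐ x) ≡ true → pathsFrom N f ok vis u x ≡ [] ∷ []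
  pathsFrom-arrived f ok vis u x u≐x with u ≐ x
  ... | true = refl

  pathsFrom-noFuel : ∀ ok vis u x → (u ≐ x) ≡ false → pathsFrom N 0 ok vis u x ≡ []
  pathsFrom-noFuel ok vis u x u≠x with u ≐ x
  ... | false = refl

  pathsFrom-step : ∀ f ok vis u x → (u ≐ x) ≡ false →
                   pathsFrom N (suc f) ok vis u x ≡ concatMap (λ e → concatMap (Extensions ok vis u x f e) (nodes N)) (edges N)
  pathsFrom-step f ok vis u x u≠x with u ≐ x
  ... | false = refl

  length-Extensions : ∀ ok vis u x f e y →
                      length (Extensions ok vis u x f e y)
                        ≡ (if CanStep ok vis u e y then length (pathsFrom N f ok (y ∷ vis) y x) else 0)
  length-Extensions ok vis u x f e y with CanStep ok vis u e y
  ... | true = length-map (e ∷_) (pathsFrom N f ok (y ∷ vis) y x)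
  ... | false = refl

  data PathView (ok : Fin m → Bool) (vis : List (Fin k)) (u x : Fin k) (q : List (Fin m)) : ℕ → Set where
    arrived : ∀ {f} → u ≡ x → q ≡ [] → PathView ok vis u x q f
    stepped : ∀ {f} e y p → (u ≐ x) ≡ false → q ≡ e ∷ p → CanStep ok vis u e y ≡ true →
              p ∈ pathsFrom N f ok (y ∷ vis) y x → PathView ok vis u x q (suc f)

  pathView : ∀ f ok vis u x q → q ∈ pathsFrom N f ok vis u x → PathView ok vis u x q f
  pathView f ok vis u x q q∈ with ⌊≟⌋-cases u x
  ... | inj₁ (u≡x , u≐x) with subst (q ∈_) (pathsFrom-arrived f ok vis u x u≐x) q∈
  ... | here refl = arrived u≡x refl
  pathView zero ok vis u x q q∈ | inj₂ (_ , u≠x) with subst (q ∈_) (pathsFrom-noFuel ok vis u x u≠x) q∈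
  ... | ()
  pathView (suc f) ok vis u x q q∈ | inj₂ (_ , u≠x)
    with find (∈-concatMap⁻ _ {xs = edges N} (subst (q ∈_) (pathsFrom-step f ok vis u x u≠x) q∈))
  ... | e , _ , q∈e with find (∈-concatMap⁻ _ {xs = nodes N} q∈e)
  ... | y , _ , q∈ey with CanStep ok vis u e y in can
  ... | true with ∈-map⁻ (e ∷_) q∈ey
  ... | p , p∈ , refl = stepped e y p u≠x refl can p∈

  []∈pathsFrom : ∀ f ok vis x → [] ∈ pathsFrom N f ok vis x x
  []∈pathsFrom f ok vis x = subst ([] ∈_) (sym (pathsFrom-arrived f ok vis x x (⌊≟⌋-refl x))) (here refl)

  ∷∈pathsFrom : ∀ f ok vis u x e y p → (u ≐ x) ≡ false → CanStep ok vis u e y ≡ true →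
                p ∈ pathsFrom N f ok (y ∷ vis) y x → (e ∷ p) ∈ pathsFrom N (suc f) ok vis u x
  ∷∈pathsFrom f ok vis u x e y p u≠x can p∈ =
    subst ((e ∷ p) ∈_) (sym (pathsFrom-step f ok vis u x u≠x))
      (∈-concatMap⁺ _ (lose (∈-allFin e) (∈-concatMap⁺ _ (lose (∈-allFin y) extension))))
    where
    extension : (e ∷ p) ∈ Extensions ok vis u x f e y
    extension rewrite can = ∈-map⁺ (e ∷_) p∈

  pathsFrom-target-fresh : ∀ f ok vis u x q → q ∈ pathsFrom N f ok vis u x → u ≡ x ⊎ x ∉ vis
  pathsFrom-target-fresh f ok vis u x q q∈ with pathView f ok vis u x q q∈
  ... | arrived u≡x _ = inj₁ u≡x
  ... | stepped {f′} e y p _ _ can p∈ with canStep⁻ {ok} {vis} can | pathsFrom-target-fresh f′ ok (y ∷ vis) y x p p∈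
  ... | _ , _ , y∉ | inj₁ refl = inj₂ y∉
  ... | _ , _ , _  | inj₂ x∉   = inj₂ (λ x∈ → x∉ (there x∈))

  pathsFrom-last-step : ∀ f ok vis u x q → q ∈ pathsFrom N f ok vis u x → u ≢ x →
                        ∃[ g ] ∃[ z ] (ok g ≡ true × step N g z x ≡ true)
  pathsFrom-last-step f ok vis u x q q∈ u≢x with pathView f ok vis u x q q∈
  ... | arrived u≡x _ = ⊥-elim (u≢x u≡x)
  ... | stepped {f′} e y p _ _ can p∈ with canStep⁻ {ok} {vis} can | ⌊≟⌋-cases y x
  ... | ok-e , s , _ | inj₁ (refl , _) = e , u , ok-e , s
  ... | _            | inj₂ (y≢x , _) = pathsFrom-last-step f′ ok (y ∷ vis) y x p p∈ y≢x

  data Walk : Fin k → Fin k → Set where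
    start  : (u : Fin k) → Walk u u
    extend : ∀ {u c} → Walk u c → (g : Fin m) (w : Fin k) → step N g c w ≡ true → Walk u w

  visited : ∀ {u c} → Walk u c → List (Fin k)
  visited (start u) = u ∷ []
  visited (extend W g w _) = w ∷ visited W

  trail : ∀ {u c} → Walk u c → List (Fin m)
  trail (start u) = []
  trail (extend W g w _) = trail W ++ (g ∷ [])

  steps : ∀ {u c} → Walk u c → ℕ
  steps (start u) = 0
  steps (extend W g w _) = suc (steps W)

  AllowedBy : (Fin m → Bool) → ∀ {u c} → Walk u c → Set
  AllowedBy ok (start u) = ⊤
  AllowedBy ok (extend W g w _) = ok g ≡ true × AllowedBy ok W

  end∈visited : ∀ {u c} (W : Walk u c) → c ∈ visited W
  end∈visited (start u) = here refl
  end∈visited (extend W g w _) = here refl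

  start∈visited : ∀ {u c} (W : Walk u c) → u ∈ visited W
  start∈visited (start u) = here refl
  start∈visited (extend W g w _) = there (start∈visited W)

  length-visited : ∀ {u c} (W : Walk u c) → length (visited W) ≡ suc (steps W)
  length-visited (start u) = refl
  length-visited (extend W g w _) = cong suc (length-visited W)

  steps<k : ∀ {u c} (W : Walk u c) → Unique (visited W) → steps W < k
  steps<k W u = subst (_≤ k) (length-visited W) (Unique⇒length≤ (visited W) u)

  walk++path∈pathsFrom : ∀ {ok u c x} (W : Walk u c) → Unique (visited W) → AllowedBy ok W → ∀ f p →
                         p ∈ pathsFrom N f ok (visited W) c x → (trail W ++ p) ∈ pathsFrom N (steps W + f) ok (u ∷ []) u x
  walk++path∈pathsFrom (start u) _ _ f p p∈ = p∈
  walk++path∈pathsFrom {ok} {u} {x = x} (extend {c = c} W g w s) (w∉ ∷ uW) (ok-g , okW) f p p∈ =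
    subst₂ (λ q F → q ∈ pathsFrom N F ok (u ∷ []) u x) (sym (++-assoc (trail W) (g ∷ []) p)) (ℕ.+-suc (steps W) f)
      (walk++path∈pathsFrom W uW okW (suc f) (g ∷ p)
        (∷∈pathsFrom f ok (visited W) c x g w p (≢⇒⌊≟⌋≡false c≢x) (canStep⁺ {ok} {visited W} ok-g s w∉′) p∈))
    where
    w∉′ : w ∉ visited W
    w∉′ = All¬⇒¬Any w∉
    c≢x : c ≢ x
    c≢x c≡x with pathsFrom-target-fresh f ok (w ∷ visited W) w x p p∈
    ... | inj₁ refl = w∉′ (subst (_∈ visited W) c≡x (end∈visited W))
    ... | inj₂ x∉ = x∉ (there (subst (_∈ visited W) c≡x (end∈visited W)))

  walk⇒path : ∀ {ok u x} (W : Walk u x) → Unique (visited W) → AllowedBy ok W → trail W ∈ pathsFrom N k ok (u ∷ []) u x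
  walk⇒path {ok} {u} {x} W uW okW =
    subst₂ (λ q F → q ∈ pathsFrom N F ok (u ∷ []) u x) (++-identityʳ (trail W)) (ℕ.m+[n∸m]≡n (ℕ.<⇒≤ (steps<k W uW)))
      (walk++path∈pathsFrom W uW okW (k ℕ.∸ steps W) [] ([]∈pathsFrom _ ok (visited W) x))

  avoiding : Fin m → Fin m → Bool
  avoiding e j = not (j ≐ᵉ e)

  avoiding-self : ∀ g → avoiding g g ≡ false
  avoiding-self g rewrite ⌊≟⌋-refl g = refl

  avoiding-other : ∀ g h → g ≢ h → avoiding h g ≡ true
  avoiding-other g h g≢h rewrite ≢⇒⌊≟⌋≡false g≢h = refl

  avoiding⇒≢ : ∀ h g → avoiding h g ≡ true → g ≢ h
  avoiding⇒≢ h g avoids refl with trans (sym avoids) (avoiding-self g)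
  ... | ()

  walk-avoids : ∀ {u c} (W : Walk u c) g z → z ∉ visited W → Incident g z → AllowedBy (avoiding g) W
  walk-avoids (start u) g z _ _ = tt
  walk-avoids (extend {c = c} W g′ w s) g z z∉ inc with ⌊≟⌋-cases g′ g
  ... | inj₂ (_ , g′≠g) = cong not g′≠g , walk-avoids W g z (λ z∈ → z∉ (there z∈)) inc
  ... | inj₁ (refl , _) with step-incident g c w z s inc
  ...   | inj₁ refl = ⊥-elim (z∉ (there (end∈visited W)))
  ...   | inj₂ refl = ⊥-elim (z∉ (here refl))

  suffix : ∀ {u c y} (W : Walk u c) → y ∈ visited W → Unique (visited W) →
           Σ (Walk y c) (λ S → Unique (visited S) × visited S ⊆ visited W)
  suffix (start u) (here refl) uW = start u , uW , λ z∈ → z∈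
  suffix (extend W g w s) (here refl) _ = start w , [] ∷ [] , λ { (here refl) → here refl }
  suffix (extend W g w s) (there y∈) (w∉ ∷ uW) with suffix W y∈ uW
  ... | S , uS , S⊆W = extend S g w s , Unique-∷ (λ w∈ → All¬⇒¬Any w∉ (S⊆W w∈)) uS ,
                       λ { (here refl) → here refl ; (there z∈) → there (S⊆W z∈) }

  -- Fuel is irrelevant once it suffices to exhaust all k nodes, so two enumerations
  -- agree as soon as the admissible steps agree along a simulation R.
  module PathsFromCong (ok₁ ok₂ : Fin m → Bool) (x : Fin k)
    (R : Fin k → List (Fin k) → List (Fin k) → Set)
    (canStep-≡ : ∀ {c vis₁ vis₂} → R c vis₁ vis₂ → ∀ g w → CanStep ok₁ vis₁ c g w ≡ CanStep ok₂ vis₂ c g w)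
    (R-step : ∀ {c vis₁ vis₂} → R c vis₁ vis₂ → ∀ g w → CanStep ok₁ vis₁ c g w ≡ true → R w (w ∷ vis₁) (w ∷ vis₂))
    where

    concatMap-[] : ∀ {A B : Set} (f : B → List A) xs → (∀ g → f g ≡ []) → concatMap f xs ≡ []
    concatMap-[] f [] _ = refl
    concatMap-[] f (g ∷ xs) empty rewrite empty g = concatMap-[] f xs empty

    no-extensions : ∀ ok vis c f → (∀ g w → CanStep ok vis c g w ≡ false) →
                    concatMap (λ e → concatMap (Extensions ok vis c x f e) (nodes N)) (edges N) ≡ []
    no-extensions ok vis c f stuck = concatMap-[] _ (edges N) (λ g → concatMap-[] _ (nodes N) (none g))
      where
      none : ∀ g w → Extensions ok vis c x f g w ≡ []
      none g w rewrite stuck g w = refl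

    exhausted : ∀ c vis₁ → Unique vis₁ → k ≤ length vis₁ → ∀ ok vis g w →
                CanStep ok₁ vis₁ c g w ≡ CanStep ok vis c g w → CanStep ok vis c g w ≡ false
    exhausted c vis₁ u full ok vis g w same with CanStep ok vis c g w
    ... | false = refl
    ... | true with canStep⁻ {ok₁} {vis₁} same
    ... | _ , _ , w∉ = ⊥-elim (ℕ.<-irrefl refl (ℕ.≤-trans (Unique⇒length≤ (w ∷ vis₁) (Unique-∷ w∉ u)) full))

    pathsFrom-cong : ∀ f₁ f₂ c vis₁ vis₂ → R c vis₁ vis₂ → Unique vis₁ →
                     k ≤ f₁ + length vis₁ → k ≤ f₂ + length vis₁ →
                     pathsFrom N f₁ ok₁ vis₁ c x ≡ pathsFrom N f₂ ok₂ vis₂ c x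
    pathsFrom-cong f₁ f₂ c vis₁ vis₂ r u enough₁ enough₂ with ⌊≟⌋-cases c x
    ... | inj₁ (_ , c≐x) = trans (pathsFrom-arrived f₁ ok₁ vis₁ c x c≐x) (sym (pathsFrom-arrived f₂ ok₂ vis₂ c x c≐x))
    pathsFrom-cong zero zero c vis₁ vis₂ r u _ _ | inj₂ (_ , c≠x) =
      trans (pathsFrom-noFuel ok₁ vis₁ c x c≠x) (sym (pathsFrom-noFuel ok₂ vis₂ c x c≠x))
    pathsFrom-cong zero (suc f₂) c vis₁ vis₂ r u enough₁ _ | inj₂ (_ , c≠x) =
      trans (pathsFrom-noFuel ok₁ vis₁ c x c≠x)
        (sym (trans (pathsFrom-step f₂ ok₂ vis₂ c x c≠x)
          (no-extensions ok₂ vis₂ c f₂ (λ g w → exhausted c vis₁ u enough₁ ok₂ vis₂ g w (canStep-≡ r g w)))))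
    pathsFrom-cong (suc f₁) zero c vis₁ vis₂ r u _ enough₂ | inj₂ (_ , c≠x) =
      trans (trans (pathsFrom-step f₁ ok₁ vis₁ c x c≠x)
                   (no-extensions ok₁ vis₁ c f₁ (λ g w → exhausted c vis₁ u enough₂ ok₁ vis₁ g w refl)))
            (sym (pathsFrom-noFuel ok₂ vis₂ c x c≠x))
    pathsFrom-cong (suc f₁) (suc f₂) c vis₁ vis₂ r u enough₁ enough₂ | inj₂ (_ , c≠x) =
      trans (pathsFrom-step f₁ ok₁ vis₁ c x c≠x)
        (trans (concatMap-cong (λ g → concatMap-cong (λ w → same-extensions g w) (nodes N)) (edges N))
               (sym (pathsFrom-step f₂ ok₂ vis₂ c x c≠x)))
      where
      same-extensions : ∀ g w → Extensions ok₁ vis₁ c x f₁ g w ≡ Extensions ok₂ vis₂ c x f₂ g w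
      same-extensions g w with CanStep ok₁ vis₁ c g w in can₁ | CanStep ok₂ vis₂ c g w in can₂
      ... | false | false = refl
      ... | true  | false = ⊥-elim (true≢false (trans (sym can₁) (trans (canStep-≡ r g w) can₂)))
      ... | false | true  = ⊥-elim (true≢false (trans (sym can₂) (trans (sym (canStep-≡ r g w)) can₁)))
      ... | true  | true with canStep⁻ {ok₁} {vis₁} can₁
      ... | _ , _ , w∉ =
        cong (map (g ∷_)) (pathsFrom-cong f₁ f₂ w (w ∷ vis₁) (w ∷ vis₂) (R-step r g w can₁) (Unique-∷ w∉ u)
                                          (subst (k ≤_) (sym (ℕ.+-suc f₁ (length vis₁))) enough₁)
                                          (subst (k ≤_) (sym (ℕ.+-suc f₂ (length vis₁))) enough₂))

module Acyclic {n : ℕ} (N : Graph n) (acyclic : HasSDCycle N → ⊥) where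

  open Graph N
  open Semidirected N

  no-cycle : ∀ g c y (W : Walk y c) → step N g c y ≡ true → Unique (visited W) → AllowedBy (avoiding g) W → ⊥
  no-cycle g c y W s uW okW = acyclic (g , c , y , ≡true⇒T s , ≡true⇒T (any-const-true⁺ (walk⇒path W uW okW)))

  no-loop : ∀ g u → step N g u u ≡ true → ⊥
  no-loop g u s = no-cycle g u u (start u) s ([] ∷ []) tt

  step⇒≢ : ∀ g u y → step N g u y ≡ true → u ≢ y
  step⇒≢ g u y s refl = no-loop g u s

  src≢tgt : ∀ g → src g ≢ tgt g
  src≢tgt g = step⇒≢ g (src g) (tgt g) (step-forward g)

  step-functional : ∀ g s y t → step N g s y ≡ true → step N g s t ≡ true → y ≡ t
  step-functional g s y t sy st with step-ends g s y sy | step-ends g s t st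
  ... | inj₁ (_ , ty) | inj₁ (_ , tt′) = trans (sym ty) tt′
  ... | inj₁ (ss , _) | inj₂ (ts , _)  = ⊥-elim (src≢tgt g (trans ss (sym ts)))
  ... | inj₂ (ts , _) | inj₁ (ss , _)  = ⊥-elim (src≢tgt g (trans ss (sym ts)))
  ... | inj₂ (_ , sy′) | inj₂ (_ , st′) = trans (sym sy′) st′

  -- After a first step g from s to y, a path avoiding h (another edge at s) that does not
  -- return to s is the same thing as a path from y avoiding g: returning to s, or using g
  -- or h at all, would close a semidirected cycle through g.
  module AfterFirstStep (s y x : Fin k) (g h : Fin m) (s→y : step N g s y ≡ true) (h-at-s : Incident h s) (g≢h : g ≢ h) where

    R : Fin k → List (Fin k) → List (Fin k) → Set
    R c vis₁ vis₂ = vis₁ ≡ vis₂ ++ (s ∷ []) × Unique vis₁ × Σ (Walk y c) (λ W → visited W ≡ vis₂ × AllowedBy (avoiding g) W)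

    R⇒c≢s : ∀ {c vis₁ vis₂} → R c vis₁ vis₂ → c ≢ s
    R⇒c≢s {vis₂ = vis₂} (refl , u , W , refl , okW) refl = no-cycle g s y W s→y (Unique-++⁻ˡ vis₂ u) okW

    canStep-≡ : ∀ {c vis₁ vis₂} → R c vis₁ vis₂ → ∀ g′ w → CanStep (avoiding h) vis₁ c g′ w ≡ CanStep (avoiding g) vis₂ c g′ w
    canStep-≡ {c} r g′ w with step N g′ c w in c→w
    ... | false rewrite ∧-zeroʳ (avoiding h g′) | ∧-zeroʳ (avoiding g g′) = refl
    ... | true with ⌊≟⌋-cases w s
    canStep-≡ {c} {vis₂ = vis₂} (refl , u , W , refl , okW) g′ w | true | inj₁ (refl , _)
      rewrite ∈⇒notIn≡false w (vis₂ ++ (w ∷ [])) (∈-++⁺ʳ vis₂ (here refl)) | ∧-zeroʳ (avoiding h g′) = closes-cycle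
      where
      closes-cycle : false ≡ avoiding g g′ ∧ (true ∧ notIn N w (visited W))
      closes-cycle with avoiding g g′ in avoids | notIn N w (visited W) in fresh
      ... | false | _ = refl
      ... | true | false = refl
      ... | true | true = ⊥-elim (no-cycle g s y (extend W g′ s c→w) s→y
                                   (Unique-∷ (notIn⇒∉ s (visited W) fresh) (Unique-++⁻ˡ (visited W) u)) (avoids , okW))
    canStep-≡ {c} {vis₂ = vis₂} r@(refl , _ , _ , _ , _) g′ w | true | inj₂ (w≢s , _)
      rewrite notIn-∷ʳ w vis₂ s w≢s with notIn N w vis₂
    ... | false rewrite ∧-zeroʳ (avoiding h g′) | ∧-zeroʳ (avoiding g g′) = refl
    ... | true rewrite ∧-identityʳ (avoiding h g′) | ∧-identityʳ (avoiding g g′) = same-avoidance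
      where
      not-at-s : ∀ e → Incident e s → step N e c w ≡ true → ⊥
      not-at-s e e-at-s c→w′ with step-incident e c w s c→w′ e-at-s
      ... | inj₁ s≡c = R⇒c≢s r (sym s≡c)
      ... | inj₂ s≡w = w≢s (sym s≡w)
      same-avoidance : avoiding h g′ ≡ avoiding g g′
      same-avoidance with ⌊≟⌋-cases g′ g | ⌊≟⌋-cases g′ h
      ... | inj₁ (refl , _) | _ = ⊥-elim (not-at-s g (step-incidentˢ g s y s→y) c→w)
      ... | inj₂ _ | inj₁ (refl , _) = ⊥-elim (not-at-s h h-at-s c→w)
      ... | inj₂ (g′≢g , _) | inj₂ (g′≢h , _) = trans (avoiding-other g′ h g′≢h) (sym (avoiding-other g′ g g′≢g))

    R-step : ∀ {c vis₁ vis₂} → R c vis₁ vis₂ → ∀ g′ w → CanStep (avoiding h) vis₁ c g′ w ≡ true → R w (w ∷ vis₁) (w ∷ vis₂)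
    R-step {c} {vis₁} {vis₂} r@(vis₁≡ , u , W , refl , okW) g′ w can with canStep⁻ {avoiding h} {vis₁} can
    ... | _ , c→w , w∉ = cong (w ∷_) vis₁≡ , Unique-∷ w∉ u , extend W g′ w c→w , refl ,
                         proj₁ (canStep⁻ {avoiding g} {vis₂} (trans (sym (canStep-≡ r g′ w)) can)) , okW

    open PathsFromCong (avoiding h) (avoiding g) x R canStep-≡ R-step

    paths-after-step : ∀ k′ → k ≡ suc k′ → pathsFrom N k′ (avoiding h) (y ∷ s ∷ []) y x ≡ pathsFrom N k (avoiding g) (y ∷ []) y x
    paths-after-step k′ k≡ =
      pathsFrom-cong k′ k y (y ∷ s ∷ []) (y ∷ []) (refl , y∷s-unique , start y , refl , tt) y∷s-unique
        (ℕ.≤-trans (ℕ.≤-reflexive k≡) (subst (suc k′ ≤_) (sym (ℕ.+-comm k′ 2)) (ℕ.n≤1+n _)))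
        (ℕ.m≤m+n k 2)
      where
      y∷s-unique : Unique (y ∷ s ∷ [])
      y∷s-unique = Unique-pair (λ y≡s → step⇒≢ g s y s→y (sym y≡s))

  -- Revisiting y would close a cycle through g along the part of the walk after y, which avoids g
  -- because its last edge is g′ ≠ g and its other edges miss c.
  step-from-end-fresh : ∀ {w c′ c y} (W : Walk w c′) g′ (c′→c : step N g′ c′ c ≡ true) g →
                        Unique (visited (extend W g′ c c′→c)) → g ≢ g′ → step N g c y ≡ true →
                        y ∉ visited (extend W g′ c c′→c)
  step-from-end-fresh W g′ c′→c g _ _ c→y (here refl) = step⇒≢ g _ _ c→y refl
  step-from-end-fresh {c = c} {y} W g′ c′→c g (c∉ ∷ uW) g≢g′ c→y (there y∈) with suffix W y∈ uW
  ... | S , uS , S⊆W = no-cycle g c y (extend S g′ c c′→c) c→y (Unique-∷ c∉S uS)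
                         (avoiding-other g′ g (λ g′≡g → g≢g′ (sym g′≡g)) , walk-avoids S g c c∉S (step-incidentˢ g c y c→y))
    where
    c∉S : c ∉ visited S
    c∉S c∈ = All¬⇒¬Any c∉ (S⊆W c∈)

  firstStepCount : Fin m → Fin k → Fin k → ℕ
  firstStepCount g s x = sum (map (λ y → if step N g s y then mcount N y x g else 0) (nodes N))

  totalPaths : Fin k → Fin k → ℕ
  totalPaths s x = sum (map (λ g → firstStepCount g s x) (edges N))

  mcount-split : ∀ h s x → Incident h s → s ≢ x →
                 mcount N s x h ≡ sum (map (λ g → if avoiding h g then firstStepCount g s x else 0) (edges N))
  mcount-split h s x h-at-s s≢x with Fin⇒suc s
  ... | k′ , k≡ = begin
      length (pathsFrom N k (avoiding h) (s ∷ []) s x)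
        ≡⟨ cong (λ f → length (pathsFrom N f (avoiding h) (s ∷ []) s x)) k≡ ⟩
      length (pathsFrom N (suc k′) (avoiding h) (s ∷ []) s x)
        ≡⟨ cong length (pathsFrom-step k′ (avoiding h) (s ∷ []) s x (≢⇒⌊≟⌋≡false s≢x)) ⟩
      length (concatMap (λ g → concatMap (Extensions (avoiding h) (s ∷ []) s x k′ g) (nodes N)) (edges N))
        ≡⟨ length-concatMap _ (edges N) ⟩
      sum (map (λ g → length (concatMap (Extensions (avoiding h) (s ∷ []) s x k′ g) (nodes N))) (edges N))
        ≡⟨ sum-map-cong (edges N) (λ g _ → length-concatMap _ (nodes N)) ⟩
      sum (map (λ g → sum (map (λ y → length (Extensions (avoiding h) (s ∷ []) s x k′ g y)) (nodes N))) (edges N))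
        ≡⟨ sum-map-cong (edges N) (λ g _ → sum-map-cong (nodes N) (λ y _ → extensions g y)) ⟩
      sum (map (λ g → sum (map (λ y → if avoiding h g then (if step N g s y then mcount N y x g else 0) else 0) (nodes N))) (edges N))
        ≡⟨ sum-map-cong (edges N) (λ g _ → sum-map-if (avoiding h g) _ (nodes N)) ⟩
      sum (map (λ g → if avoiding h g then firstStepCount g s x else 0) (edges N)) ∎
    where
    open ≡-Reasoning
    extensions : ∀ g y →
                 length (Extensions (avoiding h) (s ∷ []) s x k′ g y)
                   ≡ (if avoiding h g then (if step N g s y then mcount N y x g else 0) else 0)
    extensions g y rewrite length-Extensions (avoiding h) (s ∷ []) s x k′ g y
      with avoiding h g in avoids | step N g s y in s→y
    ... | false | _ = refl
    ... | true | false = refl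
    ... | true | true rewrite ∉⇒notIn y (s ∷ []) (λ { (here y≡s) → step⇒≢ g s y s→y (sym y≡s) }) =
      cong length (AfterFirstStep.paths-after-step s y x g h s→y h-at-s (avoiding⇒≢ h g avoids) k′ k≡)

  totalPaths-split : ∀ h s x →
                     totalPaths s x ≡ sum (map (λ g → if avoiding h g then firstStepCount g s x else 0) (edges N))
                                      + firstStepCount h s x
  totalPaths-split h s x = begin
    totalPaths s x
      ≡⟨ sum-map-cong (edges N) (λ g _ → either g) ⟩
    sum (map (λ g → (if avoiding h g then firstStepCount g s x else 0) + (if g ≐ᵉ h then firstStepCount g s x else 0)) (edges N))
      ≡⟨ sym (sum-map-+ _ _ (edges N)) ⟩
    avoiders + sum (map (λ g → if g ≐ᵉ h then firstStepCount g s x else 0) (edges N))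
      ≡⟨ cong (avoiders +_) (sum-map-if-single (_≐ᵉ h) (λ g → firstStepCount g s x) (edges N) (allFin⁺ m) (∈-allFin h)
                                                (λ _ → ⌊≟⌋⇒≡) (⌊≟⌋-refl h)) ⟩
    avoiders + firstStepCount h s x ∎
    where
    open ≡-Reasoning
    avoiders = sum (map (λ g → if avoiding h g then firstStepCount g s x else 0) (edges N))
    either : ∀ g → firstStepCount g s x
                   ≡ (if avoiding h g then firstStepCount g s x else 0) + (if g ≐ᵉ h then firstStepCount g s x else 0)
    either g with g ≐ᵉ h
    ... | true = refl
    ... | false = sym (ℕ.+-identityʳ _)

  firstStepCount-step : ∀ g s t x → step N g s t ≡ true → firstStepCount g s x ≡ mcount N t x g
  firstStepCount-step g s t x s→t =
    sum-map-if-single (λ y → step N g s y) (λ y → mcount N y x g) (nodes N) (allFin⁺ k) (∈-allFin t)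
      (λ y s→y → step-functional g s y t s→y s→t) s→t

  -- The paths from s to x either avoid g or start with g, and then continue from t avoiding g.
  edge-split : ∀ g s t x → step N g s t ≡ true → s ≢ x → mcount N s x g + mcount N t x g ≡ totalPaths s x
  edge-split g s t x s→t s≢x =
    trans (cong₂ _+_ (mcount-split g s x (step-incidentˢ g s t s→t) s≢x) (sym (firstStepCount-step g s t x s→t)))
          (sym (totalPaths-split g s x))

module Network {n : ℕ} (N : Graph n) (LN : IsLNetwork N) (BN : IsBinary N) (CN : IsComplete N) where

  open Graph N
  open IsLNetwork LN
  open IsBinary BN
  open IsComplete CN
  open Semidirected N
  open Acyclic N sdag

  -- Degrees

  outgoing : Fin m → Fin k → Bool
  outgoing g c = dirOut N g c ∨ undAt N g c

  step⇒outgoing : ∀ g c y → step N g c y ≡ true → outgoing g c ≡ true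
  step⇒outgoing g c y c→y with dir g in d | step-incidentˢ g c y c→y
  ... | true  | _ rewrite proj₁ (step-directed g c y d c→y) | ⌊≟⌋-refl c = refl
  ... | false | inj₁ refl rewrite ⌊≟⌋-refl c = refl
  ... | false | inj₂ refl rewrite ⌊≟⌋-refl c = ∨-zeroʳ _

  outgoing⇒step : ∀ g c → outgoing g c ≡ true → ∃[ y ] (step N g c y ≡ true)
  outgoing⇒step g c out with ⌊≟⌋-cases (src g) c
  ... | inj₁ (refl , _) = tgt g , step-forward g
  ... | inj₂ (_ , s≠c) with ⌊≟⌋-cases (tgt g) c
  ...   | inj₁ (refl , _) = src g , step-backward g (undirected out)
    where
    undirected : outgoing g (tgt g) ≡ true → dir g ≡ false
    undirected out rewrite s≠c with dir g
    ... | false = refl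
    undirected () | true
  ...   | inj₂ (_ , t≠c) = ⊥-elim (true≢false (trans (sym out) not-incident))
    where
    not-incident : outgoing g c ≡ false
    not-incident rewrite s≠c | t≠c with dir g
    ... | true = refl
    ... | false = refl

  leaf⇒¬outgoing : ∀ v g → isLeaf N v ≡ true → outgoing g v ≡ false
  leaf⇒¬outgoing v g leaf with outgoing g v in out
  ... | false = refl
  ... | true with ∧-true⁻ {a = not (any (λ e → dirOut N e v) (edges N))} leaf | ∨-true⁻ {a = dirOut N g v} out
  ... | no-out , _ | inj₁ g-out rewrite any⁺ (λ e → dirOut N e v) (edges N) (∈-allFin g) g-out with no-out
  ... | ()
  leaf⇒¬outgoing v g leaf | true | _ , no-und | inj₂ g-und rewrite any⁺ (λ e → undAt N e v) (edges N) (∈-allFin g) g-und with no-und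
  ... | ()

  leaf⇒¬step : ∀ v g y → isLeaf N v ≡ true → step N g v y ≡ false
  leaf⇒¬step v g y leaf with step N g v y in v→y
  ... | false = refl
  ... | true = ⊥-elim (true≢false (trans (sym (step⇒outgoing g v y v→y)) (leaf⇒¬outgoing v g leaf)))

  ¬leaf⇒outgoing : ∀ c → isLeaf N c ≡ false → ∃[ g ] (outgoing g c ≡ true)
  ¬leaf⇒outgoing c ¬leaf with any (λ e → dirOut N e c) (edges N) in some-out | any (λ e → undAt N e c) (edges N) in some-und
  ... | true | _ with any⁻ (λ e → dirOut N e c) (edges N) some-out
  ...   | g , _ , g-out = g , cong (_∨ undAt N g c) g-out
  ¬leaf⇒outgoing c ¬leaf | false | true with any⁻ (λ e → undAt N e c) (edges N) some-und
  ...   | g , _ , g-und = g , trans (cong (dirOut N g c ∨_) g-und) (∨-zeroʳ _)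
  ¬leaf⇒outgoing c () | false | false

  outdeg : Fin k → ℕ
  outdeg c = tally (λ g → outgoing g c) (edges N)

  degree≡tally : ∀ c → degree N c ≡ tally (λ e → src e ≐ c) (edges N) + tally (λ e → tgt e ≐ c) (edges N)
  degree≡tally c = cong₂ _+_ (count≡tally N (λ e → src e ≐ c) (edges N)) (count≡tally N (λ e → tgt e ≐ c) (edges N))

  indeg≡tally : ∀ c → indeg N c ≡ tally (λ e → dirIn N e c) (edges N)
  indeg≡tally c = count≡tally N (λ e → dirIn N e c) (edges N)

  degree≤outdeg+indeg : ∀ c → degree N c ≤ outdeg c + indeg N c
  degree≤outdeg+indeg c rewrite degree≡tally c | indeg≡tally c =
    tally-+-mono (λ e → src e ≐ c) (λ e → tgt e ≐ c) (λ g → outgoing g c) (λ e → dirIn N e c) (edges N) (λ g _ → pointwise g)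
    where
    pointwise : ∀ g → 𝟙 (src g ≐ c) + 𝟙 (tgt g ≐ c) ≤ 𝟙 (outgoing g c) + 𝟙 (dirIn N g c)
    pointwise g with dir g | ⌊≟⌋-cases (src g) c | ⌊≟⌋-cases (tgt g) c
    ... | _     | inj₁ (refl , _) | inj₁ (t≡ , _) = ⊥-elim (src≢tgt g (sym t≡))
    ... | true  | inj₁ (_ , s≐) | inj₂ (_ , t≠) rewrite s≐ | t≠ = s≤s z≤n
    ... | true  | inj₂ (_ , s≠) | inj₁ (_ , t≐) rewrite s≠ | t≐ = s≤s z≤n
    ... | true  | inj₂ (_ , s≠) | inj₂ (_ , t≠) rewrite s≠ | t≠ = z≤n
    ... | false | inj₁ (_ , s≐) | inj₂ (_ , t≠) rewrite s≐ | t≠ = s≤s z≤n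
    ... | false | inj₂ (_ , s≠) | inj₁ (_ , t≐) rewrite s≠ | t≐ = s≤s z≤n
    ... | false | inj₂ (_ , s≠) | inj₂ (_ , t≠) rewrite s≠ | t≠ = z≤n

  incident⇒degree≥1 : ∀ g c → Incident g c → 1 ≤ degree N c
  incident⇒degree≥1 g c inc rewrite degree≡tally c with inc
  ... | inj₁ refl = ℕ.≤-trans (ℕ.≤-trans (ℕ.≤-reflexive (sym (cong 𝟙 (⌊≟⌋-refl c))))
                               (∈⇒≤sum-map (λ e → 𝟙 (src e ≐ c)) (edges N) (∈-allFin g))) (ℕ.m≤m+n _ _)
  ... | inj₂ refl = ℕ.≤-trans (ℕ.≤-trans (ℕ.≤-reflexive (sym (cong 𝟙 (⌊≟⌋-refl c))))
                               (∈⇒≤sum-map (λ e → 𝟙 (tgt e ≐ c)) (edges N) (∈-allFin g))) (ℕ.m≤n+m _ _)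

  outdeg-bound : ∀ {c q j} → indeg N c ≤ j → q + j ≤ degree N c → q ≤ outdeg c
  outdeg-bound {c} {q} {j} in≤j q+j≤deg =
    ℕ.+-cancelʳ-≤ j q (outdeg c) (ℕ.≤-trans q+j≤deg (ℕ.≤-trans (degree≤outdeg+indeg c) (ℕ.+-monoʳ-≤ (outdeg c) in≤j)))

  outdeg≥2 : ∀ c → isLeaf N c ≡ false → isTree N c ≡ true → 2 ≤ outdeg c
  outdeg≥2 c ¬leaf tree with isRoot N c in root
  ... | false = outdeg-bound (ℕ.≤ᵇ⇒≤ (indeg N c) 1 (≡true⇒T tree))
                  (ℕ.≤-reflexive (sym (otherDeg c (≡true⇒T (cong not root)) (≡true⇒T (cong not ¬leaf)))))
  ... | true with rootDeg c (≡true⇒T root) | ℕ.≡ᵇ⇒≡ (indeg N c) 0 (≡true⇒T (proj₁ (∧-true⁻ root)))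
  ...   | inj₂ (inj₁ deg≡2) | in≡0 = outdeg-bound (ℕ.≤-reflexive in≡0) (ℕ.≤-reflexive (sym deg≡2))
  ...   | inj₂ (inj₂ deg≡3) | in≡0 = outdeg-bound (ℕ.≤-reflexive in≡0) (ℕ.≤-trans (ℕ.n≤1+n 2) (ℕ.≤-reflexive (sym deg≡3)))
  ...   | inj₁ deg≡0 | _ with ¬leaf⇒outgoing c ¬leaf
  ...     | g , out with subst (1 ≤_) deg≡0 (incident⇒degree≥1 g c (step-incidentˢ g c _ (proj₂ (outgoing⇒step g c out))))
  ...       | ()

  undirected : Fin m → Bool
  undirected j = not (dir j)

  ∼-refl : ∀ u → _∼_ N u u ≡ true
  ∼-refl u = any-const-true⁺ ([]∈pathsFrom k undirected (u ∷ []) u)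

  ∼-along : ∀ g u y → dir g ≡ false → step N g u y ≡ true → _∼_ N u y ≡ true
  ∼-along g u y d u→y =
    any-const-true⁺ (walk⇒path {undirected} (extend (start u) g y u→y)
                      (Unique-pair (λ y≡u → step⇒≢ g u y u→y (sym y≡u))) (cong not d , tt))

  undirected⇒nontrivialClass : ∀ g c → dir g ≡ false → Incident g c → nontrivialClass N c ≡ true
  undirected⇒nontrivialClass g c d (inj₁ refl) =
    any⁺ (λ w → not (w ≐ src g) ∧ _∼_ N w (src g)) (nodes N) (∈-allFin (tgt g))
      (cong₂ _∧_ (cong not (≢⇒⌊≟⌋≡false (λ t≡s → src≢tgt g (sym t≡s)))) (∼-along g (tgt g) (src g) d (step-backward g d)))
  undirected⇒nontrivialClass g c d (inj₂ refl) =
    any⁺ (λ w → not (w ≐ tgt g) ∧ _∼_ N w (tgt g)) (nodes N) (∈-allFin (src g))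
      (cong₂ _∧_ (cong not (≢⇒⌊≟⌋≡false (src≢tgt g))) (∼-along g (src g) (tgt g) d (step-forward g)))

  no-directed-into-class : ∀ r u → classHasIncoming N r ≡ false → _∼_ N u r ≡ true → ∀ g → dir g ≡ true → tgt g ≢ u
  no-directed-into-class r u no-in u∼r g d refl
    with trans (sym (any⁺ (λ e → dir e ∧ _∼_ N (tgt e) r) (edges N) (∈-allFin g) (cong₂ _∧_ d u∼r))) no-in
  ... | ()

  indeg≡0 : ∀ u → (∀ g → dir g ≡ true → tgt g ≢ u) → indeg N u ≡ 0
  indeg≡0 u none = trans (indeg≡tally u) (tally-≡0 (λ e → dirIn N e u) (edges N) not-in)
    where
    not-in : ∀ g → g ∈ edges N → dirIn N g u ≡ false
    not-in g _ with dir g in d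
    ... | false = refl
    ... | true = ≢⇒⌊≟⌋≡false (none g d)

  nontrivialClass⇒¬incoming : ∀ c → nontrivialClass N c ≡ true → classHasIncoming N c ≡ false
  nontrivialClass⇒¬incoming c nontrivial = not-true⁻ (T⇒≡true (classes c (≡true⇒T nontrivial)))

  undirected⇒indeg≡0 : ∀ g c → dir g ≡ false → Incident g c → indeg N c ≡ 0
  undirected⇒indeg≡0 g c d inc =
    indeg≡0 c (no-directed-into-class c c (nontrivialClass⇒¬incoming c (undirected⇒nontrivialClass g c d inc)) (∼-refl c))

  undirected⇒undAt : ∀ g c → dir g ≡ false → Incident g c → undAt N g c ≡ true
  undirected⇒undAt g c d (inj₁ refl) rewrite d | ⌊≟⌋-refl (src g) = refl
  undirected⇒undAt g c d (inj₂ refl) rewrite d | ⌊≟⌋-refl (tgt g) = ∨-zeroʳ _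

  undirected⇒¬root : ∀ g c → dir g ≡ false → Incident g c → isRoot N c ≡ false
  undirected⇒¬root g c d inc rewrite any⁺ (λ e → undAt N e c) (edges N) (∈-allFin g) (undirected⇒undAt g c d inc) = ∧-zeroʳ _

  undirected⇒¬leaf : ∀ g c → dir g ≡ false → Incident g c → isLeaf N c ≡ false
  undirected⇒¬leaf g c d inc rewrite any⁺ (λ e → undAt N e c) (edges N) (∈-allFin g) (undirected⇒undAt g c d inc) = ∧-zeroʳ _

  undirected⇒outdeg≥3 : ∀ g c → dir g ≡ false → Incident g c → 3 ≤ outdeg c
  undirected⇒outdeg≥3 g c d inc =
    outdeg-bound (ℕ.≤-reflexive (undirected⇒indeg≡0 g c d inc))
      (ℕ.≤-reflexive (sym (trans degree≡3 (sym (ℕ.+-identityʳ 3)))))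
    where
    degree≡3 : degree N c ≡ 3
    degree≡3 = otherDeg c (≡true⇒T (cong not (undirected⇒¬root g c d inc))) (≡true⇒T (cong not (undirected⇒¬leaf g c d inc)))

  -- Walking down to hybrids and leaves

  -- The nodes counted by the vectors μ(e,w): hybrids in coordinate 0, leaves in the coordinate of their label.
  isTarget : Fin k → Bool
  isTarget t = isHybrid N t ∨ isLeaf N t

  ¬target⇒outdeg≥2 : ∀ c → isTarget c ≡ false → 2 ≤ outdeg c
  ¬target⇒outdeg≥2 c ¬target with ∨-false⁻ {a = isHybrid N c} ¬target
  ... | ¬hybrid , ¬leaf = outdeg≥2 c ¬leaf (not-false⁻ ¬hybrid)

  outgoing-avoiding : ∀ c h → 2 ≤ outdeg c → ∃[ g ] (outgoing g c ≡ true × g ≢ h)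
  outgoing-avoiding c h two with tally≥1⇒∃ (λ g → outgoing g c ∧ not (g ≐ᵉ h)) (edges N)
                                   (ℕ.≤-pred (ℕ.≤-trans two (ℕ.≤-trans (tally-≤-drop (λ g → outgoing g c) h (edges N) (allFin⁺ m))
                                                                        (ℕ.+-monoˡ-≤ _ (𝟙≤1 (outgoing h c))))))
  ... | g , _ , out∧≠ with ∧-true⁻ {a = outgoing g c} out∧≠
  ... | out , g≠h = g , out , avoiding⇒≢ h g g≠h

  TargetWalk : Fin k → Fin m → List (Fin m) → Set
  TargetWalk w e pre = ∃[ t ] (isTarget t ≡ true ×
                         Σ (Walk w t) (λ V → Unique (visited V) × AllowedBy (avoiding e) V × ∃[ q ] (trail V ≡ pre ++ q)))

  -- Away from targets every node has a second way out, and acyclicity forbids coming back,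
  -- so the walk can be prolonged until it hits a target.
  descend : ∀ fuel e {w c′ c} (W : Walk w c′) g′ (c′→c : step N g′ c′ c ≡ true) →
            Unique (visited (extend W g′ c c′→c)) → AllowedBy (avoiding e) (extend W g′ c c′→c) → Incident e w →
            k ≤ fuel + steps (extend W g′ c c′→c) → TargetWalk w e (trail (extend W g′ c c′→c))
  descend fuel e {w} {c′} {c} W g′ c′→c u okW e-at-w enough with isTarget c in target
  ... | true = c , target , extend W g′ c c′→c , u , okW , [] , sym (++-identityʳ _)
  ... | false with outgoing-avoiding c g′ (¬target⇒outdeg≥2 c target)
  ... | g , out , g≢g′ with outgoing⇒step g c out
  ... | y , c→y = continue fuel enough
    where
    W₁ = extend W g′ c c′→c
    y∉ : y ∉ visited W₁
    y∉ = step-from-end-fresh W g′ c′→c g u g≢g′ c→y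
    g≢e : g ≢ e
    g≢e refl with step-incident e c y w c→y e-at-w
    ... | inj₁ refl = Unique[x∷xs]⇒x∉xs u (start∈visited W)
    ... | inj₂ refl = y∉ (start∈visited W₁)
    continue : ∀ fuel → k ≤ fuel + steps W₁ → TargetWalk w e (trail W₁)
    continue zero enough =
      ⊥-elim (ℕ.<-irrefl refl (ℕ.≤-trans (steps<k (extend W₁ g y c→y) (Unique-∷ y∉ u)) (ℕ.≤-trans enough (ℕ.n≤1+n _))))
    continue (suc f) enough
      with descend f e W₁ g c→y (Unique-∷ y∉ u) (avoiding-other g e g≢e , okW) e-at-w (subst (k ≤_) (sym (ℕ.+-suc f _)) enough)
    ... | t , t-target , V , uV , okV , q , trail≡ =
      t , t-target , V , uV , okV , g ∷ q , trans trail≡ (++-assoc (trail W₁) (g ∷ []) q)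

  walk-to-target : ∀ e w g y → Incident e w → step N g w y ≡ true → g ≢ e → TargetWalk w e (g ∷ [])
  walk-to-target e w g y e-at-w w→y g≢e =
    descend k e (start w) g w→y (Unique-pair (λ y≡w → step⇒≢ g w y w→y (sym y≡w))) (avoiding-other g e g≢e , tt) e-at-w
      (ℕ.m≤m+n k 1)

  reach-target : ∀ e w → Incident e w → ∃[ t ] (isTarget t ≡ true × 1 ≤ mcount N w t e)
  reach-target e w e-at-w with isTarget w in target
  ... | true = w , target , ∈-length ([]∈pathsFrom k (avoiding e) (w ∷ []) w)
  ... | false with outgoing-avoiding w e (¬target⇒outdeg≥2 w target)
  ... | g , out , g≢e with outgoing⇒step g w out
  ... | y , w→y with walk-to-target e w g y e-at-w w→y g≢e
  ... | t , t-target , V , uV , okV , _ = t , t-target , ∈-length (walk⇒path V uV okV)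

  -- The endpoints w of e whose vector μ(e,w) is tagged t or h in μ(e).
  IsHead : Fin m → Fin k → Set
  IsHead e w = (dir e ≡ true × tgt e ≡ w) ⊎ (dir e ≡ false × Incident e w)

  head⇒incident : ∀ e w → IsHead e w → Incident e w
  head⇒incident e w (inj₁ (_ , t≡w)) = inj₂ t≡w
  head⇒incident e w (inj₂ (_ , inc)) = inc

  two-outgoing-avoiding : ∀ e w → IsHead e w → isTarget w ≡ false →
                          ∃[ g₁ ] ∃[ g₂ ] ((outgoing g₁ w ≡ true × g₁ ≢ e) × (outgoing g₂ w ≡ true × g₂ ≢ e) × g₁ ≢ g₂)
  two-outgoing-avoiding e w head ¬target
    with tally≥2⇒∃₂ (λ g → outgoing g w ∧ not (g ≐ᵉ e)) (edges N) (allFin⁺ m) (two head)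
    where
    others = tally (λ g → outgoing g w ∧ not (g ≐ᵉ e)) (edges N)
    drop-e : outdeg w ≤ 𝟙 (outgoing e w) + others
    drop-e = tally-≤-drop (λ g → outgoing g w) e (edges N) (allFin⁺ m)
    two : IsHead e w → 2 ≤ others
    two (inj₁ (d , refl)) = ℕ.≤-trans (¬target⇒outdeg≥2 w ¬target) (subst (λ b → outdeg w ≤ 𝟙 b + others) e-incoming drop-e)
      where
      e-incoming : outgoing e (tgt e) ≡ false
      e-incoming rewrite d | ≢⇒⌊≟⌋≡false (src≢tgt e) = refl
    two (inj₂ (d , inc)) =
      ℕ.≤-pred (ℕ.≤-trans (undirected⇒outdeg≥3 e w d inc) (ℕ.≤-trans drop-e (ℕ.+-monoˡ-≤ others (𝟙≤1 (outgoing e w)))))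
  ... | g₁ , g₂ , out₁ , out₂ , g₁≢g₂ with ∧-true⁻ {a = outgoing g₁ w} out₁ | ∧-true⁻ {a = outgoing g₂ w} out₂
  ... | o₁ , n₁ | o₂ , n₂ = g₁ , g₂ , (o₁ , avoiding⇒≢ e g₁ n₁) , (o₂ , avoiding⇒≢ e g₂ n₂) , g₁≢g₂

  -- Coordinates of μ-vectors

  selects : Fin (suc n) → Fin k → Bool
  selects zero z = isHybrid N z
  selects (suc b) z = labelledBy N z b

  μcoord : Fin m → Fin k → Fin (suc n) → ℕ
  μcoord e w i = sum (map (λ z → if selects i z then mcount N w z e else 0) (nodes N))

  lookup-μev : ∀ e w i → lookup (μev N e w) i ≡ ℤ.+ μcoord e w i
  lookup-μev e w zero = refl
  lookup-μev e w (suc b) = lookup∘tabulate (λ j → ℤ.+ μcoord e w j) (suc b)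

  δcoord : Fin n → Fin (suc n) → ℕ
  δcoord a i = 𝟙 ⌊ i Fin.≟ suc a ⌋

  lookup-δ : ∀ a i → lookup (δ N a) i ≡ ℤ.+ δcoord a i
  lookup-δ a i = trans (lookup∘tabulate (λ j → if ⌊ j Fin.≟ suc a ⌋ then ℤ.+ 1 else ℤ.+ 0) i) (if-+ ⌊ i Fin.≟ suc a ⌋)
    where
    if-+ : ∀ b → (if b then ℤ.+ 1 else ℤ.+ 0) ≡ ℤ.+ 𝟙 b
    if-+ true = refl
    if-+ false = refl

  δcoord-off : ∀ a i → i ≢ suc a → δcoord a i ≡ 0
  δcoord-off a i i≢ rewrite ≢⇒⌊≟⌋≡false i≢ = refl

  δcoord-on : ∀ a → δcoord a (suc a) ≡ 1
  δcoord-on a rewrite ⌊≟⌋-refl (suc a) = refl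

  coords≢δ : ∀ (X : Vec ℤ (suc n)) (c : Fin (suc n) → ℕ) → (∀ i → lookup X i ≡ ℤ.+ c i) →
             ∀ a i → c i ≢ δcoord a i → X ≢ δ N a
  coords≢δ X c X-c a i c≢ X≡δ = c≢ (ℤ.+-injective (trans (sym (X-c i)) (trans (cong (λ Y → lookup Y i) X≡δ) (lookup-δ a i))))

  off-coordinate>0⇒≢δ : ∀ X c → (∀ i → lookup X i ≡ ℤ.+ c i) → ∀ a i → i ≢ suc a → 1 ≤ c i → X ≢ δ N a
  off-coordinate>0⇒≢δ X c X-c a i i≢ pos = coords≢δ X c X-c a i (λ eq → ℕ.<⇒≢ pos (sym (trans eq (δcoord-off a i i≢))))

  on-coordinate≥2⇒≢δ : ∀ X c → (∀ i → lookup X i ≡ ℤ.+ c i) → ∀ a → 2 ≤ c (suc a) → X ≢ δ N a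
  on-coordinate≥2⇒≢δ X c X-c a two = coords≢δ X c X-c a (suc a) (λ eq → ℕ.<⇒≢ two (sym (trans eq (δcoord-on a))))

  on-coordinate≡0⇒≢δ : ∀ X a → lookup X (suc a) ≡ ℤ.+ 0 → X ≢ δ N a
  on-coordinate≡0⇒≢δ X a X-a≡0 X≡δ = ℕ.0≢1+n (ℤ.+-injective (begin
    ℤ.+ 0                   ≡⟨ sym X-a≡0 ⟩
    lookup X (suc a)        ≡⟨ cong (λ Y → lookup Y (suc a)) X≡δ ⟩
    lookup (δ N a) (suc a)  ≡⟨ lookup-δ a (suc a) ⟩
    ℤ.+ δcoord a (suc a)    ≡⟨ cong ℤ.+_ (δcoord-on a) ⟩
    ℤ.+ 1                   ∎))
    where open ≡-Reasoning

  labelledBy-just : ∀ z b b′ → lab z ≡ just b′ → labelledBy N z b ≡ ⌊ b′ Fin.≟ b ⌋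
  labelledBy-just z b b′ z-b′ with lab z
  labelledBy-just z b b′ refl | just .b′ = refl

  labelledBy⇒lab : ∀ z b → labelledBy N z b ≡ true → lab z ≡ just b
  labelledBy⇒lab z b labelled with lab z
  labelledBy⇒lab z b labelled | just b′ = cong just (⌊≟⌋⇒≡ labelled)

  selected⇒target : ∀ i z → selects i z ≡ true → isTarget z ≡ true
  selected⇒target zero z hybrid rewrite hybrid = refl
  selected⇒target (suc b) z labelled rewrite T⇒≡true (onlyLeaves z b (labelledBy⇒lab z b labelled)) = ∨-zeroʳ _

  target⇒selected : ∀ t → isTarget t ≡ true → ∃[ i ] (selects i t ≡ true)
  target⇒selected t target with isHybrid N t in hybrid
  ... | true = zero , hybrid
  ... | false with labelledLeaf t (≡true⇒T target)
  ... | b , t-b = suc b , trans (labelledBy-just t b b t-b) (⌊≟⌋-refl b)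

  mcount≤μcoord : ∀ e w t i → selects i t ≡ true → mcount N w t e ≤ μcoord e w i
  mcount≤μcoord e w t i selected =
    subst (_≤ μcoord e w i) (cong (λ b → if b then mcount N w t e else 0) selected)
      (∈⇒≤sum-map (λ z → if selects i z then mcount N w z e else 0) (nodes N) (∈-allFin t))

  positive-coordinate : ∀ e w → Incident e w → ∃[ i ] (1 ≤ μcoord e w i)
  positive-coordinate e w e-at-w with reach-target e w e-at-w
  ... | t , target , reaches with target⇒selected t target
  ... | i , selected = i , ℕ.≤-trans reaches (mcount≤μcoord e w t i selected)

  endpoint-sum : Fin m → Vec ℤ (suc n)
  endpoint-sum e = Vec.zipWith ℤ._+_ (μev N e (src e)) (μev N e (tgt e))

  lookup-endpoint-sum : ∀ e l → lookup (endpoint-sum e) l ≡ ℤ.+ (μcoord e (src e) l + μcoord e (tgt e) l)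
  lookup-endpoint-sum e l = begin
    lookup (endpoint-sum e) l                                  ≡⟨ lookup-zipWith ℤ._+_ l (μev N e (src e)) (μev N e (tgt e)) ⟩
    lookup (μev N e (src e)) l ℤ.+ lookup (μev N e (tgt e)) l  ≡⟨ cong₂ ℤ._+_ (lookup-μev e (src e) l) (lookup-μev e (tgt e) l) ⟩
    ℤ.+ μcoord e (src e) l ℤ.+ ℤ.+ μcoord e (tgt e) l          ≡⟨ sym (ℤ.pos-+ (μcoord e (src e) l) (μcoord e (tgt e) l)) ⟩
    ℤ.+ (μcoord e (src e) l + μcoord e (tgt e) l)              ∎
    where open ≡-Reasoning

  endpoint-sum≢δ : ∀ e a → endpoint-sum e ≢ δ N a
  endpoint-sum≢δ e a with positive-coordinate e (src e) (inj₁ refl) | positive-coordinate e (tgt e) (inj₂ refl)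
  ... | i , pos-i | j , pos-j with i Fin.≟ suc a | j Fin.≟ suc a
  ... | no i≢ | _ = off-coordinate>0⇒≢δ (endpoint-sum e) _ (lookup-endpoint-sum e) a i i≢ (ℕ.≤-trans pos-i (ℕ.m≤m+n _ _))
  ... | yes _ | no j≢ = off-coordinate>0⇒≢δ (endpoint-sum e) _ (lookup-endpoint-sum e) a j j≢ (ℕ.≤-trans pos-j (ℕ.m≤n+m _ _))
  ... | yes refl | yes refl = on-coordinate≥2⇒≢δ (endpoint-sum e) _ (lookup-endpoint-sum e) a (ℕ.+-mono-≤ pos-i pos-j)

  -- Root components

  undirected⇒¬target : ∀ g z → dir g ≡ false → Incident g z → isTarget z ≡ false
  undirected⇒¬target g z d inc rewrite undirected⇒¬leaf g z d inc | undirected⇒indeg≡0 g z d inc = refl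

  source⇒¬target : ∀ g s → outgoing g s ≡ true → indeg N s ≡ 0 → isTarget s ≡ false
  source⇒¬target g s out in≡0 with isLeaf N s in leaf
  ... | true = ⊥-elim (true≢false (trans (sym out) (leaf⇒¬outgoing s g leaf)))
  ... | false rewrite in≡0 = refl

  target≢ : ∀ {x z} → isTarget x ≡ true → isTarget z ≡ false → z ≢ x
  target≢ x-target z-¬target refl = true≢false (trans (sym x-target) z-¬target)

  totalPaths-undirected : ∀ e u y x → dir e ≡ false → step N e u y ≡ true → isTarget x ≡ true → totalPaths u x ≡ totalPaths y x
  totalPaths-undirected e u y x d u→y x-target = begin
    totalPaths u x                  ≡⟨ sym (edge-split e u y x u→y (target≢ x-target u-¬target)) ⟩
    mcount N u x e + mcount N y x e ≡⟨ ℕ.+-comm (mcount N u x e) (mcount N y x e) ⟩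
    mcount N y x e + mcount N u x e ≡⟨ edge-split e y u x (step-reverse e u y d u→y) (target≢ x-target y-¬target) ⟩
    totalPaths y x                  ∎
    where
    open ≡-Reasoning
    u-¬target = undirected⇒¬target e u d (step-incidentˢ e u y u→y)
    y-¬target = undirected⇒¬target e y d (step-incidentᵗ e u y u→y)

  totalPaths-undirected-path : ∀ f vis u r q x → q ∈ pathsFrom N f undirected vis u r → isTarget x ≡ true →
                               totalPaths u x ≡ totalPaths r x
  totalPaths-undirected-path f vis u r q x q∈ x-target with pathView f undirected vis u r q q∈
  ... | arrived u≡r _ = cong (λ t → totalPaths t x) u≡r
  ... | stepped {f′} e y p _ _ can p∈ with canStep⁻ {undirected} {vis} can
  ... | und , u→y , _ = trans (totalPaths-undirected e u y x (not-true⁻ und) u→y x-target)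
                               (totalPaths-undirected-path f′ (y ∷ vis) y r p x p∈ x-target)

  totalPaths-∼ : ∀ u r x → _∼_ N u r ≡ true → isTarget x ≡ true → totalPaths u x ≡ totalPaths r x
  totalPaths-∼ u r x u∼r x-target with any-const-true⁻ (pathsFrom N k undirected (u ∷ []) u r) u∼r
  ... | q , q∈ = totalPaths-undirected-path k (u ∷ []) u r q x q∈ x-target

  ∼-other⇒degree≥1 : ∀ z r → z ≢ r → _∼_ N z r ≡ true → 1 ≤ degree N r
  ∼-other⇒degree≥1 z r z≢r z∼r with any-const-true⁻ (pathsFrom N k undirected (z ∷ []) z r) z∼r
  ... | q , q∈ with pathsFrom-last-step k undirected (z ∷ []) z r q q∈ z≢r
  ... | g , z′ , _ , z′→r = incident⇒degree≥1 g r (step-incidentᵗ g z′ r z′→r)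

  ∼⇒degree≥1 : ∀ g z r → Incident g z → _∼_ N z r ≡ true → 1 ≤ degree N r
  ∼⇒degree≥1 g z r g-at-z z∼r with ⌊≟⌋-cases z r
  ... | inj₁ (refl , _) = incident⇒degree≥1 g z g-at-z
  ... | inj₂ (z≢r , _) = ∼-other⇒degree≥1 z r z≢r z∼r

  adm⇒degree≥1 : ∀ e r → inAdm N e r ≡ true → 1 ≤ degree N r
  adm⇒degree≥1 e r adm with ∨-true⁻ {a = _∼_ N (src e) r} adm
  ... | inj₁ src∼r = ∼⇒degree≥1 e (src e) r (inj₁ refl) src∼r
  ... | inj₂ tgt∼r = ∼⇒degree≥1 e (tgt e) r (inj₂ refl) tgt∼r

  no-adm-edge : ∀ r e → firstEdge N (λ e → inAdm N e r) (edges N) ≡ nothing → inAdm N e r ≡ false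
  no-adm-edge r e none = firstEdge-nothing N (λ e → inAdm N e r) (edges N) e none (∈-allFin e)

  μT-adm : ∀ r e → inAdm N e r ≡ true → ∃[ e′ ] (inAdm N e′ r ≡ true × μT N r ≡ endpoint-sum e′)
  μT-adm r e adm with lab r | degree N r in deg | firstEdge N (λ e → inAdm N e r) (edges N) in first
  ... | just _  | zero  | _ = ⊥-elim (ℕ.<⇒≢ (adm⇒degree≥1 e r adm) (sym deg))
  ... | just _  | suc _ | just e′ = e′ , firstEdge-just N (λ e → inAdm N e r) (edges N) e′ first , refl
  ... | nothing | _     | just e′ = e′ , firstEdge-just N (λ e → inAdm N e r) (edges N) e′ first , refl
  ... | just _  | suc _ | nothing = ⊥-elim (true≢false (trans (sym adm) (no-adm-edge r e first)))
  ... | nothing | _     | nothing = ⊥-elim (true≢false (trans (sym adm) (no-adm-edge r e first)))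

  -- unresolvedAt scans the root components with a local helper; abstracting over rootComps N
  -- lets the helper's defining equations instantiate F in first-match-just.
  unresolvedAt-just : ∀ e r → unresolvedAt N e ≡ just r → r ∈ rootComps N × (not (resolved N r) ∧ inAdm N e r) ≡ true
  unresolvedAt-just e r with first-match-just (λ r → not (resolved N r) ∧ inAdm N e r) _ refl (λ _ _ → refl)
  ... | spec with rootComps N
  ... | rs = spec rs r

  unresolvedAt⇒root-adm : ∀ e r → unresolvedAt N e ≡ just r → classHasIncoming N r ≡ false × inAdm N e r ≡ true
  unresolvedAt⇒root-adm e r found with unresolvedAt-just e r found
  ... | r∈ , unresolved∧adm = not-true⁻ (proj₂ (∧-true⁻ {a = isRep N r} root-comp)) , proj₂ (∧-true⁻ {a = not (resolved N r)} unresolved∧adm)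
    where
    root-comp : isRootComp N r ≡ true
    root-comp = T⇒≡true (proj₂ (∈-filter⁻ (λ r → T? (isRootComp N r)) {xs = nodes N} r∈))

  module RootComponent (r : Fin k) (no-in : classHasIncoming N r ≡ false) where

    adm-totalPaths : ∀ e z → inAdm N e r ≡ true → isTarget z ≡ true → src e ≢ z × totalPaths (src e) z ≡ totalPaths r z
    adm-totalPaths e z adm z-target with _∼_ N (src e) r in src∼r
    ... | true = target≢ z-target (source⇒¬target e (src e) (step⇒outgoing e (src e) (tgt e) (step-forward e))
                                     (indeg≡0 (src e) (no-directed-into-class r (src e) no-in src∼r))) ,
                 totalPaths-∼ (src e) r z src∼r z-target
    ... | false with dir e in d
    ...   | true = ⊥-elim (no-directed-into-class r (tgt e) no-in adm e d refl)
    ...   | false = target≢ z-target (undirected⇒¬target e (src e) d (inj₁ refl)) ,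
                    trans (totalPaths-undirected e (src e) (tgt e) z d (step-forward e) z-target)
                          (totalPaths-∼ (tgt e) r z adm z-target)

    adm-mcount-sum : ∀ e e′ z → inAdm N e r ≡ true → inAdm N e′ r ≡ true → isTarget z ≡ true →
                     mcount N (src e′) z e′ + mcount N (tgt e′) z e′ ≡ mcount N (src e) z e + mcount N (tgt e) z e
    adm-mcount-sum e e′ z adm adm′ z-target with adm-totalPaths e′ z adm′ z-target | adm-totalPaths e z adm z-target
    ... | src′≢z , total′ | src≢z , total = begin
      mcount N (src e′) z e′ + mcount N (tgt e′) z e′ ≡⟨ edge-split e′ (src e′) (tgt e′) z (step-forward e′) src′≢z ⟩
      totalPaths (src e′) z                           ≡⟨ trans total′ (sym total) ⟩
      totalPaths (src e) z                            ≡⟨ sym (edge-split e (src e) (tgt e) z (step-forward e) src≢z) ⟩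
      mcount N (src e) z e + mcount N (tgt e) z e     ∎
      where open ≡-Reasoning

    adm-μcoord-sum : ∀ e e′ i → inAdm N e r ≡ true → inAdm N e′ r ≡ true →
                     μcoord e′ (src e′) i + μcoord e′ (tgt e′) i ≡ μcoord e (src e) i + μcoord e (tgt e) i
    adm-μcoord-sum e e′ i adm adm′ = begin
      μcoord e′ (src e′) i + μcoord e′ (tgt e′) i
        ≡⟨ sum-map-+ _ _ (nodes N) ⟩
      sum (map (λ z → selected z (mcount N (src e′) z e′) + selected z (mcount N (tgt e′) z e′)) (nodes N))
        ≡⟨ sum-map-cong (nodes N) (λ z _ → pointwise z) ⟩
      sum (map (λ z → selected z (mcount N (src e) z e) + selected z (mcount N (tgt e) z e)) (nodes N))
        ≡⟨ sym (sum-map-+ _ _ (nodes N)) ⟩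
      μcoord e (src e) i + μcoord e (tgt e) i ∎
      where
      open ≡-Reasoning
      selected : Fin k → ℕ → ℕ
      selected z c = if selects i z then c else 0
      pointwise : ∀ z → selected z (mcount N (src e′) z e′) + selected z (mcount N (tgt e′) z e′)
                      ≡ selected z (mcount N (src e) z e) + selected z (mcount N (tgt e) z e)
      pointwise z with selects i z in sel
      ... | false = refl
      ... | true = adm-mcount-sum e e′ z adm adm′ (selected⇒target i z sel)

  i-entry : ∀ e r → unresolvedAt N e ≡ just r → Vec.zipWith ℤ._-_ (μT N r) (μev N e (src e)) ≡ μev N e (tgt e)
  i-entry e r found with unresolvedAt⇒root-adm e r found
  ... | no-in , adm with μT-adm r e adm
  ... | e′ , adm′ , μT≡ rewrite μT≡ = lookup-ext _ _ coordinate
    where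
    coordinate : ∀ i → lookup (Vec.zipWith ℤ._-_ (endpoint-sum e′) (μev N e (src e))) i ≡ lookup (μev N e (tgt e)) i
    coordinate i = begin
      lookup (Vec.zipWith ℤ._-_ (endpoint-sum e′) (μev N e (src e))) i
        ≡⟨ lookup-zipWith ℤ._-_ i (endpoint-sum e′) (μev N e (src e)) ⟩
      lookup (endpoint-sum e′) i ℤ.- lookup (μev N e (src e)) i
        ≡⟨ cong₂ ℤ._-_ (trans (lookup-endpoint-sum e′ i) (sym (ℤ.pos-+ (μcoord e′ (src e′) i) (μcoord e′ (tgt e′) i))))
                       (lookup-μev e (src e) i) ⟩
      (ℤ.+ μcoord e′ (src e′) i ℤ.+ ℤ.+ μcoord e′ (tgt e′) i) ℤ.- ℤ.+ μcoord e (src e) i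
        ≡⟨ pos-sum-minus (μcoord e′ (src e′) i) (μcoord e′ (tgt e′) i) (μcoord e (src e) i) _
                         (RootComponent.adm-μcoord-sum r no-in e e′ i adm adm′) ⟩
      ℤ.+ μcoord e (tgt e) i
        ≡⟨ sym (lookup-μev e (tgt e) i) ⟩
      lookup (μev N e (tgt e)) i ∎
      where open ≡-Reasoning

  -- Counting the entries containing δ_a

  multiplicity-split : ∀ w → multiplicity N w ≡ tally (λ e → contains N w (μedge N e)) (edges N)
                                               + tally (λ r → contains N w ((μT N r , rr) ∷ [])) (rootComps N)
  multiplicity-split w = begin
    multiplicity N w
      ≡⟨ count≡tally N (contains N w) (μN N) ⟩
    tally (contains N w) (map (μedge N) (edges N) ++ map (λ r → (μT N r , rr) ∷ []) (rootComps N))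
      ≡⟨ tally-++ (contains N w) (map (μedge N) (edges N)) _ ⟩
    tally (contains N w) (map (μedge N) (edges N)) + tally (contains N w) (map (λ r → (μT N r , rr) ∷ []) (rootComps N))
      ≡⟨ cong₂ _+_ (tally-map (contains N w) (μedge N) (edges N))
                   (tally-map (contains N w) (λ r → (μT N r , rr) ∷ []) (rootComps N)) ⟩
    tally (λ e → contains N w (μedge N e)) (edges N) + tally (λ r → contains N w ((μT N r , rr) ∷ [])) (rootComps N) ∎
    where open ≡-Reasoning

  module LeafOf (v : Fin k) (a : Fin n) (v-a : lab v ≡ just a) where

    v-leaf : isLeaf N v ≡ true
    v-leaf = T⇒≡true (onlyLeaves v a v-a)

    selects-a⇒v : ∀ z → selects (suc a) z ≡ true → z ≡ v
    selects-a⇒v z selected = labInjective z v a (labelledBy⇒lab z a selected) v-a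

    other-target⇒≢δ : ∀ e w t → isTarget t ≡ true → 1 ≤ mcount N w t e → t ≢ v → μev N e w ≢ δ N a
    other-target⇒≢δ e w t target reaches t≢v with target⇒selected t target
    ... | i , selected =
      off-coordinate>0⇒≢δ (μev N e w) (μcoord e w) (lookup-μev e w) a i i≢ (ℕ.≤-trans reaches (mcount≤μcoord e w t i selected))
      where
      i≢ : i ≢ suc a
      i≢ refl = t≢v (selects-a⇒v t selected)

    two-paths⇒≢δ : ∀ e w → 2 ≤ mcount N w v e → μev N e w ≢ δ N a
    two-paths⇒≢δ e w two =
      on-coordinate≥2⇒≢δ (μev N e w) (μcoord e w) (lookup-μev e w) a (ℕ.≤-trans two (mcount≤μcoord e w v (suc a) v-selected))
      where
      v-selected : selects (suc a) v ≡ true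
      v-selected = trans (labelledBy-just v a a v-a) (⌊≟⌋-refl a)

    head-vector≢δ : ∀ e w → IsHead e w → w ≢ v → μev N e w ≢ δ N a
    head-vector≢δ e w head w≢v with isTarget w in target
    ... | true = other-target⇒≢δ e w w target (∈-length ([]∈pathsFrom k (avoiding e) (w ∷ []) w)) w≢v
    ... | false with two-outgoing-avoiding e w head target
    ... | g₁ , g₂ , (out₁ , g₁≢e) , (out₂ , g₂≢e) , g₁≢g₂ with outgoing⇒step g₁ w out₁ | outgoing⇒step g₂ w out₂
    ... | y₁ , w→y₁ | y₂ , w→y₂
      with walk-to-target e w g₁ y₁ (head⇒incident e w head) w→y₁ g₁≢e | walk-to-target e w g₂ y₂ (head⇒incident e w head) w→y₂ g₂≢e
    ... | t₁ , target₁ , V₁ , u₁ , ok₁ , q₁ , trail₁ | t₂ , target₂ , V₂ , u₂ , ok₂ , q₂ , trail₂ with t₁ Fin.≟ v | t₂ Fin.≟ v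
    ... | no t₁≢v | _ = other-target⇒≢δ e w t₁ target₁ (∈-length (walk⇒path V₁ u₁ ok₁)) t₁≢v
    ... | yes _ | no t₂≢v = other-target⇒≢δ e w t₂ target₂ (∈-length (walk⇒path V₂ u₂ ok₂)) t₂≢v
    ... | yes refl | yes refl = two-paths⇒≢δ e w (distinct∈⇒2≤length (walk⇒path V₁ u₁ ok₁) (walk⇒path V₂ u₂ ok₂) distinct)
      where
      distinct : trail V₁ ≢ trail V₂
      distinct same = g₁≢g₂ (∷-injectiveˡ (trans (sym trail₁) (trans same trail₂)))

    v-¬hybrid : isHybrid N v ≡ false
    v-¬hybrid rewrite T⇒≡true (leavesTree v (≡true⇒T v-leaf)) = refl

    mcount-from-v : ∀ z e → z ≢ v → mcount N v z e ≡ 0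
    mcount-from-v z e z≢v with Fin⇒suc v
    ... | k′ , k≡ = begin
      length (pathsFrom N k (avoiding e) (v ∷ []) v z)
        ≡⟨ cong (λ f → length (pathsFrom N f (avoiding e) (v ∷ []) v z)) k≡ ⟩
      length (pathsFrom N (suc k′) (avoiding e) (v ∷ []) v z)
        ≡⟨ cong length (pathsFrom-step k′ (avoiding e) (v ∷ []) v z (≢⇒⌊≟⌋≡false (λ v≡z → z≢v (sym v≡z)))) ⟩
      length (concatMap (λ g → concatMap (Extensions (avoiding e) (v ∷ []) v z k′ g) (nodes N)) (edges N))
        ≡⟨ length-concatMap _ (edges N) ⟩
      sum (map (λ g → length (concatMap (Extensions (avoiding e) (v ∷ []) v z k′ g) (nodes N))) (edges N))
        ≡⟨ sum-map-≡0 (edges N) (λ g _ → trans (length-concatMap _ (nodes N)) (sum-map-≡0 (nodes N) (λ y _ → no-extension g y))) ⟩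
      0 ∎
      where
      open ≡-Reasoning
      no-extension : ∀ g y → length (Extensions (avoiding e) (v ∷ []) v z k′ g y) ≡ 0
      no-extension g y rewrite canStep-¬step (avoiding e) (v ∷ []) v g y (leaf⇒¬step v g y v-leaf) = refl

    mcount-v-v : ∀ e → mcount N v v e ≡ 1
    mcount-v-v e = cong length (pathsFrom-arrived k (avoiding e) (v ∷ []) v v (⌊≟⌋-refl v))

    selects-v : ∀ i → 𝟙 (selects i v) ≡ δcoord a i
    selects-v zero rewrite v-¬hybrid = refl
    selects-v (suc b) rewrite labelledBy-just v b a v-a with ⌊≟⌋-cases a b
    ... | inj₁ (refl , a≐a) rewrite a≐a = sym (δcoord-on a)
    ... | inj₂ (a≢b , a≠b) rewrite a≠b = sym (δcoord-off a (suc b) (λ b≡a → a≢b (sym (suc-injective b≡a))))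

    μcoord-v : ∀ e i → μcoord e v i ≡ δcoord a i
    μcoord-v e i = begin
      μcoord e v i
        ≡⟨ sum-map-cong (nodes N) (λ z _ → only-v z) ⟩
      sum (map (λ z → if z ≐ v then 𝟙 (selects i v) else 0) (nodes N))
        ≡⟨ sum-map-if-single (_≐ v) (λ _ → 𝟙 (selects i v)) (nodes N) (allFin⁺ k) (∈-allFin v) (λ _ → ⌊≟⌋⇒≡) (⌊≟⌋-refl v) ⟩
      𝟙 (selects i v)
        ≡⟨ selects-v i ⟩
      δcoord a i ∎
      where
      open ≡-Reasoning
      only-v : ∀ z → (if selects i z then mcount N v z e else 0) ≡ (if z ≐ v then 𝟙 (selects i v) else 0)
      only-v z with ⌊≟⌋-cases z v
      ... | inj₁ (z≡v , z≐v) rewrite z≐v | z≡v | mcount-v-v e = refl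
      ... | inj₂ (z≢v , z≠v) rewrite z≠v | mcount-from-v z e z≢v with selects i z
      ...   | true = refl
      ...   | false = refl

    μev-v : ∀ e → μev N e v ≡ δ N a
    μev-v e = lookup-ext _ _ (λ i → trans (lookup-μev e v i) (trans (cong ℤ.+_ (μcoord-v e i)) (sym (lookup-δ a i))))

    undirected-endpoint≢v : ∀ e w → dir e ≡ false → Incident e w → w ≢ v
    undirected-endpoint≢v e w d inc refl = true≢false (trans (sym v-leaf) (undirected⇒¬leaf e v d inc))

    undirected-vector≢δ : ∀ e w → dir e ≡ false → Incident e w → μev N e w ≢ δ N a
    undirected-vector≢δ e w d inc = head-vector≢δ e w (inj₂ (d , inc)) (undirected-endpoint≢v e w d inc)

    head-δ : Fin m → Bool
    head-δ e = ⌊ ≡-dec ℤ._≟_ (μev N e (tgt e)) (δ N a) ⌋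

    head-contains : ∀ e → dir e ≡ true → head-δ e ≡ (tgt e ≐ v)
    head-contains e d with ⌊≟⌋-cases (tgt e) v
    ... | inj₁ (t≡v , t≐v) rewrite t≐v = ⌊⌋-yes (≡-dec ℤ._≟_ _ _) (trans (cong (μev N e) t≡v) (μev-v e))
    ... | inj₂ (t≢v , t≠v) rewrite t≠v = ⌊⌋-no (≡-dec ℤ._≟_ _ _) (head-vector≢δ e (tgt e) (inj₁ (d , refl)) t≢v)

    edge-contains : ∀ e → contains N (δ N a) (μedge N e) ≡ (tgt e ≐ v)
    edge-contains e with dir e in d | unresolvedAt N e in found
    ... | false | _
      rewrite ⌊⌋-no (≡-dec ℤ._≟_ (μev N e (tgt e)) (δ N a)) (undirected-vector≢δ e (tgt e) d (inj₂ refl))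
            | ⌊⌋-no (≡-dec ℤ._≟_ (μev N e (src e)) (δ N a)) (undirected-vector≢δ e (src e) d (inj₁ refl))
      = sym (≢⇒⌊≟⌋≡false (undirected-endpoint≢v e (tgt e) d (inj₂ refl)))
    ... | true | nothing = trans (∨-identityʳ (head-δ e)) (head-contains e d)
    ... | true | just r rewrite i-entry e r found =
      trans (cong (head-δ e ∨_) (∨-identityʳ (head-δ e))) (trans (∨-idem (head-δ e)) (head-contains e d))

    src≢v : ∀ e → src e ≢ v
    src≢v e refl = true≢false (trans (sym (step⇒outgoing e (src e) (tgt e) (step-forward e))) (leaf⇒¬outgoing (src e) e v-leaf))

    edges-containing : tally (λ e → contains N (δ N a) (μedge N e)) (edges N) ≡ degree N v
    edges-containing = begin
      tally (λ e → contains N (δ N a) (μedge N e)) (edges N)  ≡⟨ tally-cong (edges N) (λ e _ → edge-contains e) ⟩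
      into-v                                                  ≡⟨ cong (_+ into-v) (sym out-of-v≡0) ⟩
      tally (λ e → src e ≐ v) (edges N) + into-v              ≡⟨ sym (degree≡tally v) ⟩
      degree N v                                              ∎
      where
      open ≡-Reasoning
      into-v = tally (λ e → tgt e ≐ v) (edges N)
      out-of-v≡0 : tally (λ e → src e ≐ v) (edges N) ≡ 0
      out-of-v≡0 = tally-≡0 (λ e → src e ≐ v) (edges N) (λ e _ → ≢⇒⌊≟⌋≡false (src≢v e))

    δ-injective : ∀ b → δ N b ≡ δ N a → b ≡ a
    δ-injective b δb≡δa with ⌊≟⌋-cases b a
    ... | inj₁ (b≡a , _) = b≡a
    ... | inj₂ (b≢a , _) = ⊥-elim (on-coordinate≡0⇒≢δ (δ N b) a
                                     (trans (lookup-δ b (suc a)) (cong ℤ.+_ (δcoord-off b (suc a) (λ a≡b → b≢a (sym (suc-injective a≡b))))))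
                                     δb≡δa)

    zero≢δ : Vec.replicate (suc n) (ℤ.+ 0) ≢ δ N a
    zero≢δ = on-coordinate≡0⇒≢δ _ a (lookup-replicate (suc a) (ℤ.+ 0))

    μT≡δ⇒isolated-v : ∀ r → μT N r ≡ δ N a → r ≡ v × degree N v ≡ 0
    μT≡δ⇒isolated-v r μT≡δ with lab r in r-lab | degree N r in deg | firstEdge N (λ e → inAdm N e r) (edges N)
    ... | just b  | zero  | _ with δ-injective b μT≡δ
    ...   | refl = r≡v , trans (cong (degree N) (sym r≡v)) deg
      where r≡v = labInjective r v b r-lab v-a
    μT≡δ⇒isolated-v r μT≡δ | just _  | suc _ | just e′ = ⊥-elim (endpoint-sum≢δ e′ a μT≡δ)
    μT≡δ⇒isolated-v r μT≡δ | just _  | suc _ | nothing = ⊥-elim (zero≢δ μT≡δ)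
    μT≡δ⇒isolated-v r μT≡δ | nothing | _     | just e′ = ⊥-elim (endpoint-sum≢δ e′ a μT≡δ)
    μT≡δ⇒isolated-v r μT≡δ | nothing | _     | nothing = ⊥-elim (zero≢δ μT≡δ)

    isolated⇒μT≡δ : degree N v ≡ 0 → μT N v ≡ δ N a
    isolated⇒μT≡δ deg≡0 rewrite v-a | deg≡0 = refl

    isolated⇒rootComp : degree N v ≡ 0 → v ∈ rootComps N
    isolated⇒rootComp deg≡0 =
      ∈-filter⁺ (λ r → T? (isRootComp N r)) (∈-allFin v) (≡true⇒T (cong₂ _∧_ representative (cong not no-incoming)))
      where
      isolated : 1 ≤ degree N v → ⊥
      isolated pos = ℕ.<⇒≢ pos (sym deg≡0)
      representative : isRep N v ≡ true
      representative = all⁺ _ (nodes N) λ w _ → least w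
        where
        least : ∀ w → not (_∼_ N w v) ∨ ⌊ v Fin.≤? w ⌋ ≡ true
        least w with ⌊≟⌋-cases w v
        ... | inj₁ (refl , _) = trans (cong (not (_∼_ N w w) ∨_) (⌊⌋-yes (w Fin.≤? w) ℕ.≤-refl)) (∨-zeroʳ _)
        ... | inj₂ (w≢v , _) with _∼_ N w v in w∼v
        ...   | false = refl
        ...   | true = ⊥-elim (isolated (∼-other⇒degree≥1 w v w≢v w∼v))
      no-incoming : classHasIncoming N v ≡ false
      no-incoming = any-false _ (edges N) λ e _ → into-class e
        where
        into-class : ∀ e → dir e ∧ _∼_ N (tgt e) v ≡ false
        into-class e with _∼_ N (tgt e) v in t∼v
        ... | false = ∧-zeroʳ (dir e)
        ... | true = ⊥-elim (isolated (∼⇒degree≥1 e (tgt e) v (inj₂ refl) t∼v))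

    root-contains⇒isolated-v : ∀ r → contains N (δ N a) ((μT N r , rr) ∷ []) ≡ true → r ≡ v × degree N v ≡ 0
    root-contains⇒isolated-v r contains = μT≡δ⇒isolated-v r (⌊⌋-true⁻ (≡-dec ℤ._≟_ _ _) (trans (sym (∨-identityʳ _)) contains))

    roots-containing-isolated : degree N v ≡ 0 → tally (λ r → contains N (δ N a) ((μT N r , rr) ∷ [])) (rootComps N) ≡ 1
    roots-containing-isolated deg≡0 =
      sum-map-if-single _ (λ _ → 1) (rootComps N) (filter⁺ _ (allFin⁺ k)) (isolated⇒rootComp deg≡0)
        (λ r contains → proj₁ (root-contains⇒isolated-v r contains))
        (trans (∨-identityʳ _) (⌊⌋-yes (≡-dec ℤ._≟_ _ _) (isolated⇒μT≡δ deg≡0)))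

    roots-containing-attached : degree N v ≡ 1 → tally (λ r → contains N (δ N a) ((μT N r , rr) ∷ [])) (rootComps N) ≡ 0
    roots-containing-attached deg≡1 = tally-≡0 _ (rootComps N) λ r _ → not-contains r
      where
      not-contains : ∀ r → contains N (δ N a) ((μT N r , rr) ∷ []) ≡ false
      not-contains r with contains N (δ N a) ((μT N r , rr) ∷ []) in c
      ... | false = refl
      ... | true = ⊥-elim (ℕ.1+n≢0 (trans (sym deg≡1) (proj₂ (root-contains⇒isolated-v r c))))

    multiplicity-δ : multiplicity N (δ N a) ≡ 1
    multiplicity-δ with leafDeg v (≡true⇒T v-leaf)
    ... | inj₁ deg≡0 =
      trans (multiplicity-split (δ N a)) (cong₂ _+_ (trans edges-containing deg≡0) (roots-containing-isolated deg≡0))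
    ... | inj₂ deg≡1 =
      trans (multiplicity-split (δ N a)) (cong₂ _+_ (trans edges-containing deg≡1) (roots-containing-attached deg≡1))

  module Unlabelled (a : Fin n) (unlabelled : ∀ z → labelledBy N z a ≡ false) where

    Vanishes : Vec ℤ (suc n) → Set
    Vanishes X = lookup X (suc a) ≡ ℤ.+ 0

    vanishes⇒¬δ : ∀ X → Vanishes X → ⌊ ≡-dec ℤ._≟_ X (δ N a) ⌋ ≡ false
    vanishes⇒¬δ X X-a≡0 = ⌊⌋-no (≡-dec ℤ._≟_ X (δ N a)) (on-coordinate≡0⇒≢δ X a X-a≡0)

    μev-vanishes : ∀ e w → Vanishes (μev N e w)
    μev-vanishes e w = trans (lookup-μev e w (suc a)) (cong ℤ.+_ (sum-map-≡0 (nodes N) λ z _ → skipped z))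
      where
      skipped : ∀ z → (if labelledBy N z a then mcount N w z e else 0) ≡ 0
      skipped z rewrite unlabelled z = refl

    endpoint-sum-vanishes : ∀ e → Vanishes (endpoint-sum e)
    endpoint-sum-vanishes e =
      trans (lookup-zipWith ℤ._+_ (suc a) (μev N e (src e)) (μev N e (tgt e)))
            (cong₂ ℤ._+_ (μev-vanishes e (src e)) (μev-vanishes e (tgt e)))

    μT-vanishes : ∀ r → Vanishes (μT N r)
    μT-vanishes r with lab r in r-lab | degree N r | firstEdge N (λ e → inAdm N e r) (edges N)
    ... | just b  | zero  | _ = trans (lookup-δ b (suc a)) (cong ℤ.+_ (δcoord-off b (suc a) a≢b))
      where
      a≢b : suc a ≢ suc b
      a≢b a≡b = true≢false (trans (sym r-labelled) (unlabelled r))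
        where
        r-labelled : labelledBy N r a ≡ true
        r-labelled = trans (labelledBy-just r a b r-lab) (⌊⌋-yes (b Fin.≟ a) (sym (suc-injective a≡b)))
    ... | just _  | suc _ | just e′ = endpoint-sum-vanishes e′
    ... | just _  | suc _ | nothing = lookup-replicate (suc a) (ℤ.+ 0)
    ... | nothing | _     | just e′ = endpoint-sum-vanishes e′
    ... | nothing | _     | nothing = lookup-replicate (suc a) (ℤ.+ 0)

    i-vector-vanishes : ∀ r e → Vanishes (Vec.zipWith ℤ._-_ (μT N r) (μev N e (src e)))
    i-vector-vanishes r e =
      trans (lookup-zipWith ℤ._-_ (suc a) (μT N r) (μev N e (src e))) (cong₂ ℤ._-_ (μT-vanishes r) (μev-vanishes e (src e)))

    edge-¬contains : ∀ e → contains N (δ N a) (μedge N e) ≡ false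
    edge-¬contains e with dir e | unresolvedAt N e
    ... | false | _ rewrite vanishes⇒¬δ (μev N e (tgt e)) (μev-vanishes e (tgt e))
                          | vanishes⇒¬δ (μev N e (src e)) (μev-vanishes e (src e)) = refl
    ... | true | nothing rewrite vanishes⇒¬δ (μev N e (tgt e)) (μev-vanishes e (tgt e)) = refl
    ... | true | just r rewrite vanishes⇒¬δ (μev N e (tgt e)) (μev-vanishes e (tgt e))
                              | vanishes⇒¬δ (Vec.zipWith ℤ._-_ (μT N r) (μev N e (src e))) (i-vector-vanishes r e) = refl

    multiplicity-δ : multiplicity N (δ N a) ≡ 0
    multiplicity-δ = trans (multiplicity-split (δ N a))
      (cong₂ _+_ (tally-≡0 _ (edges N) (λ e _ → edge-¬contains e))
                 (tally-≡0 _ (rootComps N) (λ r _ → trans (∨-identityʳ _) (vanishes⇒¬δ (μT N r) (μT-vanishes r)))))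

  leaf⇔multiplicity-one : ∀ a → IsLeafLabel N a ⇔ (multiplicity N (δ N a) ≡ 1)
  leaf⇔multiplicity-one a = mk⇔ (λ (v , _ , v-a) → LeafOf.multiplicity-δ v a v-a) labelled
    where
    labelled : multiplicity N (δ N a) ≡ 1 → IsLeafLabel N a
    labelled once with any (λ z → labelledBy N z a) (nodes N) in some
    ... | true with any⁻ (λ z → labelledBy N z a) (nodes N) some
    ...   | v , _ , v-labelled = v , onlyLeaves v a (labelledBy⇒lab v a v-labelled) , labelledBy⇒lab v a v-labelled
    labelled once | false = ⊥-elim (ℕ.0≢1+n (trans (sym (Unlabelled.multiplicity-δ a none)) once))
      where
      none : ∀ z → labelledBy N z a ≡ false
      none z with labelledBy N z a in z-a
      ... | false = refl
      ... | true = ⊥-elim (true≢false (trans (sym (any⁺ (λ z → labelledBy N z a) (nodes N) (∈-allFin z) z-a)) some))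

lemma4 : (n : ℕ) (N : Graph n) → IsLNetwork N → IsBinary N → IsComplete N →
         (a : Fin n) → IsLeafLabel N a ⇔ (multiplicity N (δ N a) ≡ 1)
lemma4 n N LN BN CN = Network.leaf⇔multiplicity-one N LN BN CN
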